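{- Let $\tilde{L}_B(z,x)=\sum_{n,k\ge 0} b_{n,k}\,\frac{x^k z^n}{k!}$ and $\tilde{L}_R(z,x)=\sum_{n,k\ge 0} r_{n,k}\,\frac{x^k z^n}{k!}$, where $b_{n,k}$ (resp. $r_{n,k}$) is the number of isomorphism classes, up to free local exchange, of neutral (resp. normal) linear lambda terms of size $n$ whose set of free variables is a fixed set of $k$ distinct variables. Then, as formal power series, $$\tilde{L}_B(z,x) = x + \tilde{L}_B(z,x)\,\tilde{L}_R(z,x), \qquad \tilde{L}_R(z,x) = z\sum_{i=0}^\infty \frac{1}{i!}\cdot \frac{\partial^i}{\partial x^i}\tilde{L}_B(z,x).$$
   Context: Lambda terms are built from variables $x$, applications $t(u)$ and abstractions $\lambda x.t$, and are considered up to $\alpha$-equivalence (renaming of bound variables). A term is linear if every variable, free or bound by a $\lambda$, occurs exactly once; in particular in $\lambda x.t$ the variable $x$ occurs free in $t$ exactly once, and in $t(u)$ the free variables of $t$ and $u$ are disjoint. Neutral and normal terms are defined by mutual induction: (1) any variable is neutral; (2) if $t$ is neutral and $u$ is normal then $t(u)$ is neutral; (3) every neutral term is normal; (4) if $t$ is normal and $x$ is free in $t$ then $\lambda x.t$ is normal. (Normal terms are exactly the $\beta$-normal terms, i.e. those with no subterm of the form $(\lambda x.t)(u)$.) The size of a neutral or normal term is the number of times rule (3) is invoked on subterms in its derivation as neutral/normal; for a normal linear term this is its number of variable occurrences, and for a neutral linear term it is one less than its number of variable occurrences. A term $t'$ is a local exchange of $t$ if it is obtained (up to $\alpha$-equivalence)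 by replacing some subterm $\lambda x.\lambda y.u$ of $t$ by $\lambda y.\lambda x.u$. Two terms $t_1,t_2$ are isomorphic (up to free local exchange) if $t_2$ is obtained from $t_1$ by a finite sequence of local exchanges. Free variables are not renamed under this equivalence (they are labeled). -}

module Defs where

open import Data.Nat as ℕ using (ℕ; zero; suc; _≤_; _<ᵇ_; _≡ᵇ_; _!)
open import Data.Nat.Properties using (_!≢0)
open import Data.Fin using (Fin)
open import Data.Bool using (Bool; true; false; if_then_else_)
open import Data.Product using (Σ; ∃; _×_)
open import Data.Integer using (+_)
open import Data.Rational using (ℚ; 0ℚ; 1ℚ; _+_; _*_; _/_)
open import Relation.Binary.PropositionalEquality using (_≡_)
open import Relation.Binary.Construct.Closure.ReflexiveTransitive using (Star)

-- Lambda terms, locally nameless: free variables are labelled by ℕ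
-- (they are never renamed), bound variables are de Bruijn indices, so
-- syntactic equality of Tm is exactly α-equivalence.

data Tm : Set where
  fv  : ℕ → Tm
  bv  : ℕ → Tm
  app : Tm → Tm → Tm
  lam : Tm → Tm

occF : ℕ → Tm → ℕ
occF a (fv b)    = if a ≡ᵇ b then 1 else 0
occF a (bv i)    = 0
occF a (app t u) = occF a t ℕ.+ occF a u
occF a (lam t)   = occF a t

occB : ℕ → Tm → ℕ
occB d (fv b)    = 0
occB d (bv i)    = if i ≡ᵇ d then 1 else 0
occB d (app t u) = occB d t ℕ.+ occB d u
occB d (lam t)   = occB (suc d) t

data Scoped : ℕ → Tm → Set where
  fv  : ∀ {d a} → Scoped d (fv a)
  bv  : ∀ {d i} → suc i ≤ d → Scoped d (bv i)
  app : ∀ {d t u} → Scoped d t → Scoped d u → Scoped d (app t u)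
  lam : ∀ {d t} → Scoped (suc d) t → Scoped d (lam t)

data LamsLinear : Tm → Set where
  fv  : ∀ {a} → LamsLinear (fv a)
  bv  : ∀ {i} → LamsLinear (bv i)
  app : ∀ {t u} → LamsLinear t → LamsLinear u → LamsLinear (app t u)
  lam : ∀ {t} → occB 0 t ≡ 1 → LamsLinear t → LamsLinear (lam t)

LinearK : ℕ → Tm → Set
LinearK k t = Scoped 0 t × LamsLinear t
            × (∀ a → occF a t ≡ (if a <ᵇ k then 1 else 0))

mutual
  data Neutral : Tm → ℕ → Set where
    varF : ∀ {a} → Neutral (fv a) 0
    varB : ∀ {i} → Neutral (bv i) 0
    app  : ∀ {t u m p} → Neutral t m → Normal u p → Neutral (app t u) (m ℕ.+ p)

  data Normal : Tm → ℕ → Set where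
    neu : ∀ {t m} → Neutral t m → Normal t (suc m)
    lam : ∀ {t n} → Normal t n → 0 ℕ.< occB 0 t → Normal (lam t) n

swap : ℕ → Tm → Tm
swap d (fv a)    = fv a
swap d (bv i)    = if i ≡ᵇ d then bv (suc d) else (if i ≡ᵇ suc d then bv d else bv i)
swap d (app t u) = app (swap d t) (swap d u)
swap d (lam t)   = lam (swap (suc d) t)

data LocalExchange : Tm → Tm → Set where
  here : ∀ {u} → LocalExchange (lam (lam u)) (lam (lam (swap 0 u)))
  appˡ : ∀ {t t′ u} → LocalExchange t t′ → LocalExchange (app t u) (app t′ u)
  appʳ : ∀ {t u u′} → LocalExchange u u′ → LocalExchange (app t u) (app t u′)
  lam  : ∀ {t t′} → LocalExchange t t′ → LocalExchange (lam t) (lam t′)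

Iso : Tm → Tm → Set
Iso = Star LocalExchange

NumClasses : (Tm → Set) → ℕ → Set
NumClasses P m = Σ (Fin m → Tm) λ rep →
    (∀ i → P (rep i))
  × (∀ i j → Iso (rep i) (rep j) → i ≡ j)
  × (∀ t → P t → ∃ λ i → Iso t (rep i))

CountsNeutral : (ℕ → ℕ → ℕ) → Set
CountsNeutral b = ∀ n k → NumClasses (λ t → LinearK k t × Neutral t n) (b n k)

CountsNormal : (ℕ → ℕ → ℕ) → Set
CountsNormal r = ∀ n k → NumClasses (λ t → LinearK k t × Normal t n) (r n k)

-- Formal power series in z, x over ℚ: F n k = coefficient of z^n x^k.

FPS : Set
FPS = ℕ → ℕ → ℚ

_≗ₛ_ : FPS → FPS → Set
F ≗ₛ G = ∀ n k → F n k ≡ G n k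

sumQ : ℕ → (ℕ → ℚ) → ℚ
sumQ zero    f = 0ℚ
sumQ (suc N) f = sumQ N f + f N

ℕ→ℚ : ℕ → ℚ
ℕ→ℚ m = (+ m) / 1

inv! : ℕ → ℚ
inv! i = ((+ 1) / (i !)) {{i !≢0}}

egf : (ℕ → ℕ → ℕ) → FPS
egf c n k = ℕ→ℚ (c n k) * inv! k

X : FPS
X zero (suc zero) = 1ℚ
X _    _          = 0ℚ

_⊕_ : FPS → FPS → FPS
(F ⊕ G) n k = F n k + G n k

_⊗_ : FPS → FPS → FPS
(F ⊗ G) n k = sumQ (suc n) λ a → sumQ (suc k) λ j → F a j * G (n ℕ.∸ a) (k ℕ.∸ j)

zMul : FPS → FPS
zMul F zero    k = 0ℚ
zMul F (suc n) k = F n k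

scale : ℚ → FPS → FPS
scale c F n k = c * F n k

∂x : FPS → FPS
∂x F n k = ℕ→ℚ (suc k) * F n (suc k)

∂x^ : ℕ → FPS → FPS
∂x^ zero    F = F
∂x^ (suc i) F = ∂x (∂x^ i F)

-- S = Σ_{i ≥ 0} F i in the formal (coefficientwise) topology:
-- each coefficient is eventually 0 along i, and S is the finite sum.
HasSum : (ℕ → FPS) → FPS → Set
HasSum F S = ∀ n k → ∃ λ N → (∀ i → N ≤ i → F i n k ≡ 0ℚ)
                             × S n k ≡ sumQ N (λ i → F i n k)

-- A neutral term is a free variable or an application t(u) of a neutral t
-- to a normal u, the free variables being split between t and u, and local
-- exchanges act on t and u separately. Counting classes this way gives
-- b(n,k) = [n = 0, k = 1] + Σ_{a<n} Σ_j C(k,j) b(a,j) r(n-a,k-j), the first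
-- equation. A normal term of size n + 1 is a neutral body under i leading
-- λ's. Abstracting a fresh free variable maps the classes with i leading λ's
-- and k + 1 free variables (i + 1)-to-one onto those with i + 1 leading λ's
-- and k free variables: the preimages of a class are obtained by opening
-- one of its i + 1 leading binders, any of which can be brought to the front
-- by exchanges, and which binder was opened can be read off the result.
-- Hence the classes with i leading λ's number b(n,k+i)/i!, so
-- r(n+1,k) = Σ_i b(n,k+i)/i!, which is the second equation.

module Submission where

open import Defs
open import Data.Nat as ℕ using (ℕ; zero; suc; _≤_; _<_; z≤n; s≤s; _≡ᵇ_; _<ᵇ_; _!)
import Data.Nat.Properties as NP
import Algebra.Properties.CommutativeSemigroup NP.+-commutativeSemigroup as ℕ+
open import Data.Bool using (Bool; true; false; if_then_else_)
open import Data.List using (List; []; _∷_; length; upTo; applyUpTo)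
open import Data.List.Properties using (length-applyUpTo)
open import Data.Fin as F using (Fin; toℕ)
import Data.Fin.Properties as FP
open import Data.Product using (Σ; ∃; _×_; _,_; proj₁; proj₂)
open import Data.Sum using (_⊎_; inj₁; inj₂)
open import Data.Empty using (⊥; ⊥-elim)
open import Relation.Nullary using (¬_; Dec; yes; no)
open import Relation.Binary.PropositionalEquality
open import Function using (_∘_)
open import Relation.Binary.Construct.Closure.ReflexiveTransitive using (ε; _◅_; _◅◅_)

module Syntax where

  open import Data.Nat using (_+_; _*_)

  ≡ᵇ-cases : ∀ i d → (i ≡ d × (i ≡ᵇ d) ≡ true) ⊎ (i ≢ d × (i ≡ᵇ d) ≡ false)
  ≡ᵇ-cases zero    zero    = inj₁ (refl , refl)
  ≡ᵇ-cases zero    (suc d) = inj₂ ((λ ()) , refl)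
  ≡ᵇ-cases (suc i) zero    = inj₂ ((λ ()) , refl)
  ≡ᵇ-cases (suc i) (suc d) with ≡ᵇ-cases i d
  ... | inj₁ (i≡d , b) = inj₁ (cong suc i≡d , b)
  ... | inj₂ (i≢d , b) = inj₂ ((λ e → i≢d (NP.suc-injective e)) , b)

  ≡ᵇ-refl : ∀ i → (i ≡ᵇ i) ≡ true
  ≡ᵇ-refl zero    = refl
  ≡ᵇ-refl (suc i) = ≡ᵇ-refl i

  ≡ᵇ-sym : ∀ i d → (i ≡ᵇ d) ≡ (d ≡ᵇ i)
  ≡ᵇ-sym zero    zero    = refl
  ≡ᵇ-sym zero    (suc d) = refl
  ≡ᵇ-sym (suc i) zero    = refl
  ≡ᵇ-sym (suc i) (suc d) = ≡ᵇ-sym i d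

  ⟦_⟧ : Bool → ℕ
  ⟦ b ⟧ = if b then 1 else 0

  swapIndex : ℕ → ℕ → ℕ
  swapIndex zero    zero          = 1
  swapIndex zero    (suc zero)    = 0
  swapIndex zero    (suc (suc i)) = suc (suc i)
  swapIndex (suc d) zero          = zero
  swapIndex (suc d) (suc i)       = suc (swapIndex d i)

  swapIndex-involutive : ∀ d i → swapIndex d (swapIndex d i) ≡ i
  swapIndex-involutive zero    zero          = refl
  swapIndex-involutive zero    (suc zero)    = refl
  swapIndex-involutive zero    (suc (suc i)) = refl
  swapIndex-involutive (suc d) zero          = refl
  swapIndex-involutive (suc d) (suc i)       = cong suc (swapIndex-involutive d i)

  swapIndex-≡ᵇ : ∀ d i e → (swapIndex d i ≡ᵇ e) ≡ (i ≡ᵇ swapIndex d e)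
  swapIndex-≡ᵇ zero    zero          zero          = refl
  swapIndex-≡ᵇ zero    zero          (suc zero)    = refl
  swapIndex-≡ᵇ zero    zero          (suc (suc e)) = refl
  swapIndex-≡ᵇ zero    (suc zero)    zero          = refl
  swapIndex-≡ᵇ zero    (suc zero)    (suc zero)    = refl
  swapIndex-≡ᵇ zero    (suc zero)    (suc (suc e)) = refl
  swapIndex-≡ᵇ zero    (suc (suc i)) zero          = refl
  swapIndex-≡ᵇ zero    (suc (suc i)) (suc zero)    = refl
  swapIndex-≡ᵇ zero    (suc (suc i)) (suc (suc e)) = refl
  swapIndex-≡ᵇ (suc d) zero          zero          = refl
  swapIndex-≡ᵇ (suc d) zero          (suc e)       = refl
  swapIndex-≡ᵇ (suc d) (suc i)       zero          = refl
  swapIndex-≡ᵇ (suc d) (suc i)       (suc e)       = swapIndex-≡ᵇ d i e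

  swapIndex-< : ∀ d i D → suc d < D → i < D → swapIndex d i < D
  swapIndex-< zero    zero          D       d<D       i<D       = d<D
  swapIndex-< zero    (suc zero)    (suc D) d<D       i<D       = s≤s z≤n
  swapIndex-< zero    (suc (suc i)) D       d<D       i<D       = i<D
  swapIndex-< (suc d) zero          D       d<D       i<D       = i<D
  swapIndex-< (suc d) (suc i)       (suc D) (s≤s d<D) (s≤s i<D) = s≤s (swapIndex-< d i D d<D i<D)

  swapIndex-fixes-above : ∀ c d → suc c < d → swapIndex c d ≡ d
  swapIndex-fixes-above zero    (suc zero)    (s≤s ())
  swapIndex-fixes-above zero    (suc (suc d)) c<d       = refl
  swapIndex-fixes-above (suc c) (suc d)       (s≤s c<d) = cong suc (swapIndex-fixes-above c d c<d)

  shift : Tm → Tm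
  shift (bv j) = bv (suc j)
  shift t      = t

  shift-if : ∀ b (x y : Tm) → shift (if b then x else y) ≡ (if b then shift x else shift y)
  shift-if true  x y = refl
  shift-if false x y = refl

  swap-bv : ∀ d i → swap d (bv i) ≡ bv (swapIndex d i)
  swap-bv zero    zero          = refl
  swap-bv zero    (suc zero)    = refl
  swap-bv zero    (suc (suc i)) = refl
  swap-bv (suc d) zero          = refl
  swap-bv (suc d) (suc i)       =
    trans (sym (trans (shift-if (i ≡ᵇ d) _ _) (cong (if i ≡ᵇ d then _ else_) (shift-if (i ≡ᵇ suc d) _ _))))
          (cong shift (swap-bv d i))

  swap-involutive : ∀ d t → swap d (swap d t) ≡ t
  swap-involutive d (fv a)    = refl
  swap-involutive d (bv i)    =
    trans (cong (swap d) (swap-bv d i))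
          (trans (swap-bv d (swapIndex d i)) (cong bv (swapIndex-involutive d i)))
  swap-involutive d (app t u) = cong₂ app (swap-involutive d t) (swap-involutive d u)
  swap-involutive d (lam t)   = cong lam (swap-involutive (suc d) t)

  occF-swap : ∀ a d t → occF a (swap d t) ≡ occF a t
  occF-swap a d (fv b)    = refl
  occF-swap a d (bv i)    = cong (occF a) (swap-bv d i)
  occF-swap a d (app t u) = cong₂ _+_ (occF-swap a d t) (occF-swap a d u)
  occF-swap a d (lam t)   = occF-swap a (suc d) t

  occB-swap : ∀ e d t → occB e (swap d t) ≡ occB (swapIndex d e) t
  occB-swap e d (fv b)    = refl
  occB-swap e d (bv i)    = trans (cong (occB e) (swap-bv d i)) (cong ⟦_⟧ (swapIndex-≡ᵇ d i e))
  occB-swap e d (app t u) = cong₂ _+_ (occB-swap e d t) (occB-swap e d u)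
  occB-swap e d (lam t)   = occB-swap (suc e) (suc d) t

  leadingLams : Tm → ℕ
  leadingLams (lam t) = suc (leadingLams t)
  leadingLams _       = 0

  leadingLams-swap : ∀ d t → leadingLams (swap d t) ≡ leadingLams t
  leadingLams-swap d (fv a)    = refl
  leadingLams-swap d (bv i)    = cong leadingLams (swap-bv d i)
  leadingLams-swap d (app t u) = refl
  leadingLams-swap d (lam t)   = cong suc (leadingLams-swap (suc d) t)

  Scoped-suc : ∀ {d t} → Scoped d t → Scoped (suc d) t
  Scoped-suc fv         = fv
  Scoped-suc (bv i<d)   = bv (NP.m≤n⇒m≤1+n i<d)
  Scoped-suc (app s s′) = app (Scoped-suc s) (Scoped-suc s′)
  Scoped-suc (lam s)    = lam (Scoped-suc s)

  Scoped-swap : ∀ {D t} d → suc d < D → Scoped D t → Scoped D (swap d t)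
  Scoped-swap d d<D fv                  = fv
  Scoped-swap {D} {bv i} d d<D (bv i<D) = subst (Scoped D) (sym (swap-bv d i)) (bv (swapIndex-< d i D d<D i<D))
  Scoped-swap d d<D (app s s′)          = app (Scoped-swap d d<D s) (Scoped-swap d d<D s′)
  Scoped-swap d d<D (lam s)             = lam (Scoped-swap (suc d) (s≤s d<D) s)

  mutual
    Neutral-swap : ∀ {t m} d → Neutral t m → Neutral (swap d t) m
    Neutral-swap d varF              = varF
    Neutral-swap {bv i} d varB       = subst (λ s → Neutral s 0) (sym (swap-bv d i)) varB
    Neutral-swap d (app tⁿ uⁿ)       = app (Neutral-swap d tⁿ) (Normal-swap d uⁿ)

    Normal-swap : ∀ {t m} d → Normal t m → Normal (swap d t) m
    Normal-swap d (neu tⁿ)             = neu (Neutral-swap d tⁿ)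
    Normal-swap {lam t} d (lam tⁿ occ) =
      lam (Normal-swap (suc d) tⁿ) (subst (0 <_) (sym (occB-swap 0 (suc d) t)) occ)


  data Shape : Set where
    fvˢ  : ℕ → Shape
    bvˢ  : Shape
    appˢ : Shape → Shape → Shape
    lamˢ : Shape → Shape

  shape : Tm → Shape
  shape (fv a)    = fvˢ a
  shape (bv i)    = bvˢ
  shape (app t u) = appˢ (shape t) (shape u)
  shape (lam t)   = lamˢ (shape t)

  shape-swap : ∀ d t → shape (swap d t) ≡ shape t
  shape-swap d (fv a)    = refl
  shape-swap d (bv i)    = cong shape (swap-bv d i)
  shape-swap d (app t u) = cong₂ appˢ (shape-swap d t) (shape-swap d u)
  shape-swap d (lam t)   = cong lamˢ (shape-swap (suc d) t)

  appˢ-injective : ∀ {a b c d} → appˢ a b ≡ appˢ c d → a ≡ c × b ≡ d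
  appˢ-injective refl = refl , refl

  lamˢ-injective : ∀ {a c} → lamˢ a ≡ lamˢ c → a ≡ c
  lamˢ-injective refl = refl

  LocalExchange-sym : ∀ {t t′} → LocalExchange t t′ → LocalExchange t′ t
  LocalExchange-sym (here {u}) =
    subst (λ w → LocalExchange (lam (lam (swap 0 u))) (lam (lam w))) (swap-involutive 0 u) here
  LocalExchange-sym (appˡ x) = appˡ (LocalExchange-sym x)
  LocalExchange-sym (appʳ x) = appʳ (LocalExchange-sym x)
  LocalExchange-sym (lam x)  = lam (LocalExchange-sym x)

  LocalExchange-occF : ∀ a {t t′} → LocalExchange t t′ → occF a t ≡ occF a t′
  LocalExchange-occF a (here {u}) = sym (occF-swap a 0 u)
  LocalExchange-occF a (appˡ x)   = cong (_+ _) (LocalExchange-occF a x)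
  LocalExchange-occF a (appʳ x)   = cong (_ +_) (LocalExchange-occF a x)
  LocalExchange-occF a (lam x)    = LocalExchange-occF a x

  LocalExchange-occB : ∀ e {t t′} → LocalExchange t t′ → occB e t ≡ occB e t′
  LocalExchange-occB e (here {u}) = sym (occB-swap (suc (suc e)) 0 u)
  LocalExchange-occB e (appˡ x)   = cong (_+ _) (LocalExchange-occB e x)
  LocalExchange-occB e (appʳ x)   = cong (_ +_) (LocalExchange-occB e x)
  LocalExchange-occB e (lam x)    = LocalExchange-occB (suc e) x

  LocalExchange-shape : ∀ {t t′} → LocalExchange t t′ → shape t ≡ shape t′
  LocalExchange-shape (here {u}) = sym (cong (λ s → lamˢ (lamˢ s)) (shape-swap 0 u))
  LocalExchange-shape (appˡ x)   = cong (λ s → appˢ s _) (LocalExchange-shape x)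
  LocalExchange-shape (appʳ x)   = cong (appˢ _) (LocalExchange-shape x)
  LocalExchange-shape (lam x)    = cong lamˢ (LocalExchange-shape x)

  LocalExchange-leadingLams : ∀ {t t′} → LocalExchange t t′ → leadingLams t ≡ leadingLams t′
  LocalExchange-leadingLams (here {u}) = cong (λ n → suc (suc n)) (sym (leadingLams-swap 0 u))
  LocalExchange-leadingLams (appˡ x)   = refl
  LocalExchange-leadingLams (appʳ x)   = refl
  LocalExchange-leadingLams (lam x)    = cong suc (LocalExchange-leadingLams x)

  LocalExchange-Scoped : ∀ {d t t′} → LocalExchange t t′ → Scoped d t → Scoped d t′
  LocalExchange-Scoped here     (lam (lam s)) = lam (lam (Scoped-swap 0 (s≤s (s≤s z≤n)) s))
  LocalExchange-Scoped (appˡ x) (app s s′)    = app (LocalExchange-Scoped x s) s′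
  LocalExchange-Scoped (appʳ x) (app s s′)    = app s (LocalExchange-Scoped x s′)
  LocalExchange-Scoped (lam x)  (lam s)       = lam (LocalExchange-Scoped x s)

  mutual
    LocalExchange-Neutral : ∀ {t t′ m} → LocalExchange t t′ → Neutral t m → Neutral t′ m
    LocalExchange-Neutral (appˡ x) (app tⁿ uⁿ) = app (LocalExchange-Neutral x tⁿ) uⁿ
    LocalExchange-Neutral (appʳ x) (app tⁿ uⁿ) = app tⁿ (LocalExchange-Normal x uⁿ)

    LocalExchange-Normal : ∀ {t t′ m} → LocalExchange t t′ → Normal t m → Normal t′ m
    LocalExchange-Normal here       (neu ())
    LocalExchange-Normal (here {u}) (lam (lam uⁿ occ₀) occ₁) =
      lam (lam (Normal-swap 0 uⁿ) (subst (0 <_) (sym (occB-swap 0 0 u)) occ₁))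
          (subst (0 <_) (sym (occB-swap 1 0 u)) occ₀)
    LocalExchange-Normal (appˡ x)   (neu tⁿ)      = neu (LocalExchange-Neutral (appˡ x) tⁿ)
    LocalExchange-Normal (appʳ x)   (neu tⁿ)      = neu (LocalExchange-Neutral (appʳ x) tⁿ)
    LocalExchange-Normal (lam x)    (neu ())
    LocalExchange-Normal (lam x)    (lam tⁿ occ)  =
      lam (LocalExchange-Normal x tⁿ) (subst (0 <_) (LocalExchange-occB 0 x) occ)

  Iso-sym : ∀ {t t′} → Iso t t′ → Iso t′ t
  Iso-sym ε       = ε
  Iso-sym (x ◅ i) = Iso-sym i ◅◅ (LocalExchange-sym x ◅ ε)

  Iso-trans : ∀ {a b c} → Iso a b → Iso b c → Iso a c
  Iso-trans = _◅◅_

  Iso-lam : ∀ {t t′} → Iso t t′ → Iso (lam t) (lam t′)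
  Iso-lam ε       = ε
  Iso-lam (x ◅ i) = lam x ◅ Iso-lam i

  Iso-appˡ : ∀ {t t′ u} → Iso t t′ → Iso (app t u) (app t′ u)
  Iso-appˡ ε       = ε
  Iso-appˡ (x ◅ i) = appˡ x ◅ Iso-appˡ i

  Iso-appʳ : ∀ {t u u′} → Iso u u′ → Iso (app t u) (app t u′)
  Iso-appʳ ε       = ε
  Iso-appʳ (x ◅ i) = appʳ x ◅ Iso-appʳ i

  Iso-app : ∀ {t t′ u u′} → Iso t t′ → Iso u u′ → Iso (app t u) (app t′ u′)
  Iso-app i j = Iso-appˡ i ◅◅ Iso-appʳ j

  Iso-app⁻¹ : ∀ {t u s} → Iso (app t u) s →
              Σ Tm λ t′ → Σ Tm λ u′ → s ≡ app t′ u′ × Iso t t′ × Iso u u′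
  Iso-app⁻¹ ε = _ , _ , refl , ε , ε
  Iso-app⁻¹ (appˡ x ◅ i) with Iso-app⁻¹ i
  ... | t′ , u′ , refl , it , iu = t′ , u′ , refl , x ◅ it , iu
  Iso-app⁻¹ (appʳ x ◅ i) with Iso-app⁻¹ i
  ... | t′ , u′ , refl , it , iu = t′ , u′ , refl , it , x ◅ iu

  Iso-fv⁻¹ : ∀ {a s} → Iso (fv a) s → s ≡ fv a
  Iso-fv⁻¹ ε        = refl
  Iso-fv⁻¹ (() ◅ i)

  Iso-occF : ∀ a {t t′} → Iso t t′ → occF a t ≡ occF a t′
  Iso-occF a ε       = refl
  Iso-occF a (x ◅ i) = trans (LocalExchange-occF a x) (Iso-occF a i)

  Iso-shape : ∀ {t t′} → Iso t t′ → shape t ≡ shape t′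
  Iso-shape ε       = refl
  Iso-shape (x ◅ i) = trans (LocalExchange-shape x) (Iso-shape i)

  Iso-leadingLams : ∀ {t t′} → Iso t t′ → leadingLams t ≡ leadingLams t′
  Iso-leadingLams ε       = refl
  Iso-leadingLams (x ◅ i) = trans (LocalExchange-leadingLams x) (Iso-leadingLams i)

  Iso-Scoped : ∀ {d t t′} → Iso t t′ → Scoped d t → Scoped d t′
  Iso-Scoped ε       s = s
  Iso-Scoped (x ◅ i) s = Iso-Scoped i (LocalExchange-Scoped x s)

  Iso-Neutral : ∀ {t t′ m} → Iso t t′ → Neutral t m → Neutral t′ m
  Iso-Neutral ε       n = n
  Iso-Neutral (x ◅ i) n = Iso-Neutral i (LocalExchange-Neutral x n)


  IsVar : Tm → Set
  IsVar t = (Σ ℕ λ a → t ≡ fv a) ⊎ (Σ ℕ λ j → t ≡ bv j)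

  -- The variable replacing index i when index d is instantiated by x
  -- (indices above d are lowered by one).
  instantiateVar : ℕ → ℕ → ℕ → Tm
  instantiateVar zero    x zero    = fv x
  instantiateVar zero    x (suc i) = bv i
  instantiateVar (suc d) x zero    = bv zero
  instantiateVar (suc d) x (suc i) = shift (instantiateVar d x i)

  instantiate : ℕ → ℕ → Tm → Tm
  instantiate d x (fv a)    = fv a
  instantiate d x (bv i)    = instantiateVar d x i
  instantiate d x (app t u) = app (instantiate d x t) (instantiate d x u)
  instantiate d x (lam t)   = lam (instantiate (suc d) x t)

  instantiateVar-IsVar : ∀ d x i → IsVar (instantiateVar d x i)
  instantiateVar-IsVar zero    x zero    = inj₁ (x , refl)
  instantiateVar-IsVar zero    x (suc i) = inj₂ (i , refl)
  instantiateVar-IsVar (suc d) x zero    = inj₂ (0 , refl)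
  instantiateVar-IsVar (suc d) x (suc i) with instantiateVar d x i | instantiateVar-IsVar d x i
  ... | _ | inj₁ (a , refl) = inj₁ (a , refl)
  ... | _ | inj₂ (j , refl) = inj₂ (suc j , refl)

  instantiateVar-self : ∀ d x → instantiateVar d x d ≡ fv x
  instantiateVar-self zero    x = refl
  instantiateVar-self (suc d) x = cong shift (instantiateVar-self d x)

  instantiateVar-< : ∀ d x i → i < d → instantiateVar d x i ≡ bv i
  instantiateVar-< (suc d) x zero    i<d       = refl
  instantiateVar-< (suc d) x (suc i) (s≤s i<d) = cong shift (instantiateVar-< d x i i<d)

  shift-swap : ∀ e t → IsVar t → shift (swap e t) ≡ swap (suc e) (shift t)
  shift-swap e _ (inj₁ (a , refl)) = refl
  shift-swap e _ (inj₂ (j , refl)) = trans (cong shift (swap-bv e j)) (sym (swap-bv (suc e) (suc j)))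

  swap-zero-shift² : ∀ t → IsVar t → swap 0 (shift (shift t)) ≡ shift (shift t)
  swap-zero-shift² _ (inj₁ (a , refl)) = refl
  swap-zero-shift² _ (inj₂ (j , refl)) = refl

  instantiate-suc : ∀ d x u → instantiate (suc d) x u ≡ instantiate d x (swap d u)
  instantiate-suc d x (fv a)    = refl
  instantiate-suc d x (bv i)    = trans (var d i) (cong (instantiate d x) (sym (swap-bv d i)))
    where
    var : ∀ d i → instantiateVar (suc d) x i ≡ instantiateVar d x (swapIndex d i)
    var zero    zero          = refl
    var zero    (suc zero)    = refl
    var zero    (suc (suc i)) = refl
    var (suc d) zero          = refl
    var (suc d) (suc i)       = cong shift (var d i)
  instantiate-suc d x (app t u) = cong₂ app (instantiate-suc d x t) (instantiate-suc d x u)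
  instantiate-suc d x (lam t)   = cong lam (instantiate-suc (suc d) x t)

  instantiate-swap-below : ∀ d e x w → d ≤ e →
                           instantiate d x (swap (suc e) w) ≡ swap e (instantiate d x w)
  instantiate-swap-below d e x (fv a)    d≤e = refl
  instantiate-swap-below d e x (bv i)    d≤e = trans (cong (instantiate d x) (swap-bv (suc e) i)) (var d e i d≤e)
    where
    var : ∀ d e i → d ≤ e → instantiateVar d x (swapIndex (suc e) i) ≡ swap e (instantiateVar d x i)
    var zero    e       zero    d≤e       = refl
    var zero    e       (suc i) d≤e       = sym (swap-bv e i)
    var (suc d) (suc e) zero    d≤e       = sym (swap-bv (suc e) 0)
    var (suc d) (suc e) (suc i) (s≤s d≤e) =
      trans (cong shift (var d e i d≤e)) (shift-swap e (instantiateVar d x i) (instantiateVar-IsVar d x i))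
  instantiate-swap-below d e x (app t u) d≤e =
    cong₂ app (instantiate-swap-below d e x t d≤e) (instantiate-swap-below d e x u d≤e)
  instantiate-swap-below d e x (lam t)   d≤e = cong lam (instantiate-swap-below (suc d) (suc e) x t (s≤s d≤e))

  instantiate-swap-above : ∀ c e x u → suc (suc c) ≤ e →
                           instantiate e x (swap c u) ≡ swap c (instantiate e x u)
  instantiate-swap-above c e x (fv a)    c<e = refl
  instantiate-swap-above c e x (bv i)    c<e = trans (cong (instantiate e x) (swap-bv c i)) (var c e i c<e)
    where
    var : ∀ c e i → suc (suc c) ≤ e → instantiateVar e x (swapIndex c i) ≡ swap c (instantiateVar e x i)
    var zero    (suc zero)    i             (s≤s ())
    var zero    (suc (suc e)) zero          c<e = refl
    var zero    (suc (suc e)) (suc zero)    c<e = refl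
    var zero    (suc (suc e)) (suc (suc i)) c<e =
      sym (swap-zero-shift² (instantiateVar e x i) (instantiateVar-IsVar e x i))
    var (suc c) (suc e)       zero          c<e = sym (swap-bv (suc c) 0)
    var (suc c) (suc e)       (suc i)       (s≤s c<e) =
      trans (cong shift (var c e i c<e)) (shift-swap c (instantiateVar e x i) (instantiateVar-IsVar e x i))
  instantiate-swap-above c e x (app t u) c<e =
    cong₂ app (instantiate-swap-above c e x t c<e) (instantiate-swap-above c e x u c<e)
  instantiate-swap-above c e x (lam t)   c<e = cong lam (instantiate-swap-above (suc c) (suc e) x t (s≤s c<e))

  occF-instantiate : ∀ a d x t → occF a (instantiate d x t) ≡ occF a t + ⟦ a ≡ᵇ x ⟧ * occB d t
  occF-instantiate a d x (fv b)    = sym (trans (cong (occF a (fv b) +_) (NP.*-zeroʳ ⟦ a ≡ᵇ x ⟧)) (NP.+-identityʳ _))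
  occF-instantiate a d x (bv i)    = var d i
    where
    var : ∀ d i → occF a (instantiateVar d x i) ≡ ⟦ a ≡ᵇ x ⟧ * ⟦ i ≡ᵇ d ⟧
    var zero    zero    = sym (NP.*-identityʳ _)
    var zero    (suc i) = sym (NP.*-zeroʳ ⟦ a ≡ᵇ x ⟧)
    var (suc d) zero    = sym (NP.*-zeroʳ ⟦ a ≡ᵇ x ⟧)
    var (suc d) (suc i) with instantiateVar d x i | instantiateVar-IsVar d x i | var d i
    ... | _ | inj₁ (b , refl) | eq = eq
    ... | _ | inj₂ (j , refl) | eq = eq
  occF-instantiate a d x (app t u) = begin
    occF a (instantiate d x t) + occF a (instantiate d x u)
      ≡⟨ cong₂ _+_ (occF-instantiate a d x t) (occF-instantiate a d x u) ⟩
    (occF a t + c * occB d t) + (occF a u + c * occB d u)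
      ≡⟨ ℕ+.interchange (occF a t) _ (occF a u) _ ⟩
    (occF a t + occF a u) + (c * occB d t + c * occB d u)
      ≡⟨ cong (occF a t + occF a u +_) (sym (NP.*-distribˡ-+ c (occB d t) (occB d u))) ⟩
    (occF a t + occF a u) + c * (occB d t + occB d u) ∎
    where
    open ≡-Reasoning
    c = ⟦ a ≡ᵇ x ⟧
  occF-instantiate a d x (lam t)   = occF-instantiate a (suc d) x t

  -- The index that becomes e after instantiating index d.
  skipIndex : ℕ → ℕ → ℕ
  skipIndex zero    e       = suc e
  skipIndex (suc d) zero    = zero
  skipIndex (suc d) (suc e) = suc (skipIndex d e)

  occB-instantiate : ∀ e d x t → occB e (instantiate d x t) ≡ occB (skipIndex d e) t
  occB-instantiate e d x (fv a)    = refl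
  occB-instantiate e d x (bv i)    = var e d i
    where
    var : ∀ e d i → occB e (instantiateVar d x i) ≡ occB (skipIndex d e) (bv i)
    var e       zero    zero    = refl
    var e       zero    (suc i) = refl
    var zero    (suc d) zero    = refl
    var (suc e) (suc d) zero    = refl
    var e       (suc d) (suc i) with instantiateVar d x i | instantiateVar-IsVar d x i | var (ℕ.pred e) d i
    var zero    (suc d) (suc i) | _ | inj₁ (b , refl) | _  = refl
    var zero    (suc d) (suc i) | _ | inj₂ (j , refl) | _  = refl
    var (suc e) (suc d) (suc i) | _ | inj₁ (b , refl) | eq = eq
    var (suc e) (suc d) (suc i) | _ | inj₂ (j , refl) | eq = eq
  occB-instantiate e d x (app t u) = cong₂ _+_ (occB-instantiate e d x t) (occB-instantiate e d x u)
  occB-instantiate e d x (lam t)   = occB-instantiate (suc e) (suc d) x t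

  Scoped-instantiate : ∀ {D t} d x → d ≤ D → Scoped (suc D) t → Scoped D (instantiate d x t)
  Scoped-instantiate d x d≤D fv                  = fv
  Scoped-instantiate {D} {bv i} d x d≤D (bv i<D) = var d D i d≤D i<D
    where
    var : ∀ d D i → d ≤ D → i < suc D → Scoped D (instantiateVar d x i)
    var zero    D       zero    d≤D       i<D       = fv
    var zero    D       (suc i) d≤D       (s≤s i<D) = bv i<D
    var (suc d) (suc D) zero    d≤D       i<D       = bv (s≤s z≤n)
    var (suc d) (suc D) (suc i) (s≤s d≤D) (s≤s i<D) with instantiateVar d x i | instantiateVar-IsVar d x i | var d D i d≤D i<D
    ... | _ | inj₁ (b , refl) | s      = fv
    ... | _ | inj₂ (j , refl) | bv j<D = bv (s≤s j<D)
  Scoped-instantiate d x d≤D (app s s′)          = app (Scoped-instantiate d x d≤D s) (Scoped-instantiate d x d≤D s′)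
  Scoped-instantiate d x d≤D (lam s)             = lam (Scoped-instantiate (suc d) x (s≤s d≤D) s)

  IsVar-LamsLinear : ∀ t → IsVar t → LamsLinear t
  IsVar-LamsLinear _ (inj₁ (b , refl)) = fv
  IsVar-LamsLinear _ (inj₂ (j , refl)) = bv

  IsVar-Neutral : ∀ t → IsVar t → Neutral t 0
  IsVar-Neutral _ (inj₁ (b , refl)) = varF
  IsVar-Neutral _ (inj₂ (j , refl)) = varB

  IsVar-leadingLams : ∀ t → IsVar t → leadingLams t ≡ 0
  IsVar-leadingLams _ (inj₁ (b , refl)) = refl
  IsVar-leadingLams _ (inj₂ (j , refl)) = refl

  LamsLinear-instantiate : ∀ {t} d x → LamsLinear t → LamsLinear (instantiate d x t)
  LamsLinear-instantiate d x fv               = fv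
  LamsLinear-instantiate {bv i} d x bv        = IsVar-LamsLinear _ (instantiateVar-IsVar d x i)
  LamsLinear-instantiate d x (app l l′)       = app (LamsLinear-instantiate d x l) (LamsLinear-instantiate d x l′)
  LamsLinear-instantiate {lam t} d x (lam e l) =
    lam (trans (occB-instantiate 0 (suc d) x t) e) (LamsLinear-instantiate (suc d) x l)

  mutual
    Neutral-instantiate : ∀ {t m} d x → Neutral t m → Neutral (instantiate d x t) m
    Neutral-instantiate d x varF          = varF
    Neutral-instantiate {bv i} d x varB   = IsVar-Neutral _ (instantiateVar-IsVar d x i)
    Neutral-instantiate d x (app tⁿ uⁿ)   = app (Neutral-instantiate d x tⁿ) (Normal-instantiate d x uⁿ)

    Normal-instantiate : ∀ {t m} d x → Normal t m → Normal (instantiate d x t) m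
    Normal-instantiate d x (neu tⁿ)             = neu (Neutral-instantiate d x tⁿ)
    Normal-instantiate {lam t} d x (lam tⁿ occ) =
      lam (Normal-instantiate (suc d) x tⁿ) (subst (0 <_) (sym (occB-instantiate 0 (suc d) x t)) occ)

  leadingLams-instantiate : ∀ d x t → leadingLams (instantiate d x t) ≡ leadingLams t
  leadingLams-instantiate d x (fv a)    = refl
  leadingLams-instantiate d x (bv i)    = IsVar-leadingLams _ (instantiateVar-IsVar d x i)
  leadingLams-instantiate d x (app t u) = refl
  leadingLams-instantiate d x (lam t)   = cong suc (leadingLams-instantiate (suc d) x t)

  shape-instantiateVar : ∀ d x i → shape (instantiateVar d x i) ≡ (if i ≡ᵇ d then fvˢ x else bvˢ)
  shape-instantiateVar zero    x zero    = refl
  shape-instantiateVar zero    x (suc i) = refl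
  shape-instantiateVar (suc d) x zero    = refl
  shape-instantiateVar (suc d) x (suc i) with instantiateVar d x i | instantiateVar-IsVar d x i | shape-instantiateVar d x i
  ... | _ | inj₁ (b , refl) | eq = eq
  ... | _ | inj₂ (j , refl) | eq = eq

  shape-instantiate-≢ : ∀ d e x w → shape (instantiate d x w) ≡ shape (instantiate e x w) → d ≢ e → occB d w ≡ 0
  shape-instantiate-≢ d e x (fv a)    eq d≢e = refl
  shape-instantiate-≢ d e x (bv i)    eq d≢e with ≡ᵇ-cases i d
  ... | inj₂ (_ , i≠d) = cong ⟦_⟧ i≠d
  ... | inj₁ (refl , i=d) with ≡ᵇ-cases i e
  ...   | inj₁ (refl , _)   = ⊥-elim (d≢e refl)
  ...   | inj₂ (_ , i≠e) with trans (sym (shape-instantiateVar i x i)) (trans eq (shape-instantiateVar e x i))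
  ...     | fv≡bv rewrite i=d | i≠e with fv≡bv
  ...       | ()
  shape-instantiate-≢ d e x (app t u) eq d≢e =
    cong₂ _+_ (shape-instantiate-≢ d e x t (proj₁ (appˢ-injective eq)) d≢e)
              (shape-instantiate-≢ d e x u (proj₂ (appˢ-injective eq)) d≢e)
  shape-instantiate-≢ d e x (lam t)   eq d≢e =
    shape-instantiate-≢ (suc d) (suc e) x t (lamˢ-injective eq) (d≢e ∘ NP.suc-injective)

  LocalExchange-instantiate : ∀ {a b} d x → LocalExchange a b → LocalExchange (instantiate d x a) (instantiate d x b)
  LocalExchange-instantiate d x (here {u}) =
    subst (λ w → LocalExchange (lam (lam (instantiate (suc (suc d)) x u))) (lam (lam w)))
          (sym (instantiate-swap-above 0 (suc (suc d)) x u (s≤s (s≤s z≤n)))) here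
  LocalExchange-instantiate d x (appˡ y) = appˡ (LocalExchange-instantiate d x y)
  LocalExchange-instantiate d x (appʳ y) = appʳ (LocalExchange-instantiate d x y)
  LocalExchange-instantiate d x (lam y)  = lam (LocalExchange-instantiate (suc d) x y)


  close : ℕ → ℕ → Tm → Tm
  close x d (fv a)    = if a ≡ᵇ x then bv d else fv a
  close x d (bv i)    = bv i
  close x d (app t u) = app (close x d t) (close x d u)
  close x d (lam t)   = lam (close x (suc d) t)

  instantiate-close : ∀ {d t} x → Scoped d t → instantiate d x (close x d t) ≡ t
  instantiate-close {d} {fv a} x fv with ≡ᵇ-cases a x
  ... | inj₁ (refl , a=x) rewrite a=x = instantiateVar-self d a
  ... | inj₂ (_ , a≠x)    rewrite a≠x = refl
  instantiate-close {d} {bv i} x (bv i<d) = instantiateVar-< d x i i<d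
  instantiate-close x (app s s′) = cong₂ app (instantiate-close x s) (instantiate-close x s′)
  instantiate-close x (lam s)    = cong lam (instantiate-close x s)

  close-instantiate : ∀ {d t} x → occF x t ≡ 0 → Scoped (suc d) t → close x d (instantiate d x t) ≡ t
  close-instantiate {d} {fv a} x o fv with ≡ᵇ-cases a x
  ... | inj₁ (refl , a=x) rewrite a=x with o
  ...   | ()
  close-instantiate {d} {fv a} x o fv | inj₂ (_ , a≠x) rewrite a≠x = refl
  close-instantiate {d} {bv i} x o (bv i≤d) with NP.m≤n⇒m<n∨m≡n (NP.≤-pred i≤d)
  ... | inj₁ i<d  rewrite instantiateVar-< d x i i<d = refl
  ... | inj₂ refl rewrite instantiateVar-self i x | ≡ᵇ-refl x = refl
  close-instantiate x o (app s s′) =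
    cong₂ app (close-instantiate x (NP.m+n≡0⇒m≡0 _ o) s) (close-instantiate x (NP.m+n≡0⇒n≡0 _ o) s′)
  close-instantiate x o (lam s)    = cong lam (close-instantiate x o s)

  occF-close : ∀ a x d t → occF a (close x d t) ≡ (if a ≡ᵇ x then 0 else occF a t)
  occF-close a x d (fv b) with ≡ᵇ-cases b x
  ... | inj₁ (refl , b=x) rewrite b=x with a ≡ᵇ b
  ...   | true  = refl
  ...   | false = refl
  occF-close a x d (fv b) | inj₂ (b≢x , b≠x) rewrite b≠x with ≡ᵇ-cases a x
  ...   | inj₂ (_ , a≠x) rewrite a≠x = refl
  ...   | inj₁ (refl , a=x) rewrite a=x with ≡ᵇ-cases a b
  ...     | inj₁ (refl , _)  = ⊥-elim (b≢x refl)
  ...     | inj₂ (_ , a≠b) rewrite a≠b = refl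
  occF-close a x d (bv i) with a ≡ᵇ x
  ... | true  = refl
  ... | false = refl
  occF-close a x d (app t u) rewrite occF-close a x d t | occF-close a x d u with a ≡ᵇ x
  ... | true  = refl
  ... | false = refl
  occF-close a x d (lam t) = occF-close a x (suc d) t

  occB-close : ∀ e x d t → occB e (close x d t) ≡ occB e t + ⟦ e ≡ᵇ d ⟧ * occF x t
  occB-close e x d (fv a) with ≡ᵇ-cases a x
  ... | inj₁ (refl , a=x) rewrite a=x | ≡ᵇ-refl a = trans (cong ⟦_⟧ (≡ᵇ-sym d e)) (sym (NP.*-identityʳ _))
  ... | inj₂ (_ , a≠x)    rewrite a≠x | ≡ᵇ-sym x a | a≠x = sym (NP.*-zeroʳ ⟦ e ≡ᵇ d ⟧)
  occB-close e x d (bv i)    = sym (trans (cong (occB e (bv i) +_) (NP.*-zeroʳ ⟦ e ≡ᵇ d ⟧)) (NP.+-identityʳ _))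
  occB-close e x d (app t u) = begin
    occB e (close x d t) + occB e (close x d u)
      ≡⟨ cong₂ _+_ (occB-close e x d t) (occB-close e x d u) ⟩
    (occB e t + c * occF x t) + (occB e u + c * occF x u)
      ≡⟨ ℕ+.interchange (occB e t) _ (occB e u) _ ⟩
    (occB e t + occB e u) + (c * occF x t + c * occF x u)
      ≡⟨ cong (occB e t + occB e u +_) (sym (NP.*-distribˡ-+ c (occF x t) (occF x u))) ⟩
    (occB e t + occB e u) + c * (occF x t + occF x u) ∎
    where
    open ≡-Reasoning
    c = ⟦ e ≡ᵇ d ⟧
  occB-close e x d (lam t)   = occB-close (suc e) x (suc d) t

  occB-zero-close-suc : ∀ x d t → occB 0 (close x (suc d) t) ≡ occB 0 t
  occB-zero-close-suc x d t = trans (occB-close 0 x (suc d) t) (NP.+-identityʳ _)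

  Scoped-close : ∀ {d t} x → Scoped d t → Scoped (suc d) (close x d t)
  Scoped-close {d} {fv a} x fv with a ≡ᵇ x
  ... | true  = bv NP.≤-refl
  ... | false = fv
  Scoped-close x (bv i<d)   = Scoped-suc (bv i<d)
  Scoped-close x (app s s′) = app (Scoped-close x s) (Scoped-close x s′)
  Scoped-close x (lam s)    = lam (Scoped-close x s)

  LamsLinear-close : ∀ {t} x d → LamsLinear t → LamsLinear (close x d t)
  LamsLinear-close {fv a} x d fv with a ≡ᵇ x
  ... | true  = bv
  ... | false = fv
  LamsLinear-close x d bv               = bv
  LamsLinear-close x d (app l l′)       = app (LamsLinear-close x d l) (LamsLinear-close x d l′)
  LamsLinear-close {lam t} x d (lam e l) = lam (trans (occB-zero-close-suc x d t) e) (LamsLinear-close x (suc d) l)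

  mutual
    Neutral-close : ∀ {t m} x d → Neutral t m → Neutral (close x d t) m
    Neutral-close {fv a} x d varF with a ≡ᵇ x
    ... | true  = varB
    ... | false = varF
    Neutral-close x d varB        = varB
    Neutral-close x d (app tⁿ uⁿ) = app (Neutral-close x d tⁿ) (Normal-close x d uⁿ)

    Normal-close : ∀ {t m} x d → Normal t m → Normal (close x d t) m
    Normal-close x d (neu tⁿ)             = neu (Neutral-close x d tⁿ)
    Normal-close {lam t} x d (lam tⁿ occ) =
      lam (Normal-close x (suc d) tⁿ) (subst (0 <_) (sym (occB-zero-close-suc x d t)) occ)

  leadingLams-close : ∀ x d t → leadingLams (close x d t) ≡ leadingLams t
  leadingLams-close x d (fv a) with a ≡ᵇ x
  ... | true  = refl
  ... | false = refl
  leadingLams-close x d (bv i)    = refl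
  leadingLams-close x d (app t u) = refl
  leadingLams-close x d (lam t)   = cong suc (leadingLams-close x (suc d) t)

  close-swap : ∀ x c d u → suc c < d → close x d (swap c u) ≡ swap c (close x d u)
  close-swap x c d (fv a) c<d with a ≡ᵇ x
  ... | true  = sym (trans (swap-bv c d) (cong bv (swapIndex-fixes-above c d c<d)))
  ... | false = refl
  close-swap x c d (bv i)    c<d = trans (cong (close x d) (swap-bv c i)) (sym (swap-bv c i))
  close-swap x c d (app t u) c<d = cong₂ app (close-swap x c d t c<d) (close-swap x c d u c<d)
  close-swap x c d (lam t)   c<d = cong lam (close-swap x (suc c) (suc d) t (s≤s c<d))

  LocalExchange-close : ∀ {a b} x d → LocalExchange a b → LocalExchange (close x d a) (close x d b)
  LocalExchange-close x d (here {u}) =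
    subst (λ w → LocalExchange (lam (lam (close x (suc (suc d)) u))) (lam (lam w)))
          (sym (close-swap x 0 (suc (suc d)) u (s≤s (s≤s z≤n)))) here
  LocalExchange-close x d (appˡ y) = appˡ (LocalExchange-close x d y)
  LocalExchange-close x d (appʳ y) = appʳ (LocalExchange-close x d y)
  LocalExchange-close x d (lam y)  = lam (LocalExchange-close x (suc d) y)

  Iso-close : ∀ {a b} x d → Iso a b → Iso (close x d a) (close x d b)
  Iso-close x d ε       = ε
  Iso-close x d (y ◅ i) = LocalExchange-close x d y ◅ Iso-close x d i

  Scoped-occB : ∀ {d t} e → Scoped d t → d ≤ e → occB e t ≡ 0
  Scoped-occB e fv         d≤e = refl
  Scoped-occB {d} {bv i} e (bv i<d) d≤e with ≡ᵇ-cases i e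
  ... | inj₁ (refl , _) = ⊥-elim (NP.<⇒≱ i<d d≤e)
  ... | inj₂ (_ , i≠e)  = cong ⟦_⟧ i≠e
  Scoped-occB e (app s s′) d≤e = cong₂ _+_ (Scoped-occB e s d≤e) (Scoped-occB e s′ d≤e)
  Scoped-occB e (lam s)    d≤e = Scoped-occB (suc e) s (s≤s d≤e)

  openBinder : ℕ → ℕ → Tm → Tm
  openBinder x p       (fv a)    = fv a
  openBinder x p       (bv i)    = bv i
  openBinder x p       (app t u) = app t u
  openBinder x zero    (lam t)   = instantiate 0 x t
  openBinder x (suc p) (lam t)   = lam (openBinder x p t)

  lamBind : ℕ → Tm → Tm
  lamBind x t = lam (close x 0 t)

  openBinder-swap : ∀ x p c w → openBinder x p (swap c w) ≡ swap c (openBinder x p w)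
  openBinder-swap x p       c (fv a)    = refl
  openBinder-swap x p       c (bv i)    = trans (cong (openBinder x p) (swap-bv c i)) (sym (swap-bv c i))
  openBinder-swap x p       c (app t u) = refl
  openBinder-swap x zero    c (lam t)   = instantiate-swap-below 0 c x t z≤n
  openBinder-swap x (suc p) c (lam t)   = cong lam (openBinder-swap x p (suc c) t)

  leadingLams-openBinder : ∀ x p t → p < leadingLams t → suc (leadingLams (openBinder x p t)) ≡ leadingLams t
  leadingLams-openBinder x zero    (lam t) p<   = cong suc (leadingLams-instantiate 0 x t)
  leadingLams-openBinder x (suc p) (lam t) (s≤s p<) = cong suc (leadingLams-openBinder x p t p<)

  Scoped-openBinder : ∀ {d} x p s → Scoped d s → Scoped d (openBinder x p s)
  Scoped-openBinder x p       (fv a)    sc      = sc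
  Scoped-openBinder x p       (bv i)    sc      = sc
  Scoped-openBinder x p       (app t u) sc      = sc
  Scoped-openBinder x zero    (lam t)   (lam sc) = Scoped-instantiate 0 x z≤n sc
  Scoped-openBinder x (suc p) (lam t)   (lam sc) = lam (Scoped-openBinder x p t sc)

  occB-openBinder : ∀ e x p s → occB e (openBinder x p s) ≡ occB e s
  occB-openBinder e x p       (fv a)    = refl
  occB-openBinder e x p       (bv i)    = refl
  occB-openBinder e x p       (app t u) = refl
  occB-openBinder e x zero    (lam t)   = occB-instantiate e 0 x t
  occB-openBinder e x (suc p) (lam t)   = occB-openBinder (suc e) x p t

  LamsLinear-openBinder : ∀ x p s → LamsLinear s → LamsLinear (openBinder x p s)
  LamsLinear-openBinder x p       (fv a)    l         = l
  LamsLinear-openBinder x p       (bv i)    l         = l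
  LamsLinear-openBinder x p       (app t u) l         = l
  LamsLinear-openBinder x zero    (lam t)   (lam e l) = LamsLinear-instantiate 0 x l
  LamsLinear-openBinder x (suc p) (lam t)   (lam e l) =
    lam (trans (occB-openBinder 0 x p t) e) (LamsLinear-openBinder x p t l)

  Normal-openBinder : ∀ {m} x p s → Normal s m → Normal (openBinder x p s) m
  Normal-openBinder x p       (fv a)    n             = n
  Normal-openBinder x p       (bv i)    n             = n
  Normal-openBinder x p       (app t u) n             = n
  Normal-openBinder x zero    (lam t)   (lam n occ)   = Normal-instantiate 0 x n
  Normal-openBinder x (suc p) (lam t)   (lam n occ)   =
    lam (Normal-openBinder x p t n) (subst (0 <_) (sym (occB-openBinder 0 x p t)) occ)

  occF-openBinder : ∀ a x p s → p < leadingLams s → LamsLinear s →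
                    occF a (openBinder x p s) ≡ occF a s + ⟦ a ≡ᵇ x ⟧
  occF-openBinder a x zero    (lam t) p<       (lam e l) =
    trans (occF-instantiate a 0 x t) (cong (occF a t +_) (trans (cong (⟦ a ≡ᵇ x ⟧ *_) e) (NP.*-identityʳ _)))
  occF-openBinder a x (suc p) (lam t) (s≤s p<) (lam e l) = occF-openBinder a x p t p< l

  openBinder-lamBind : ∀ x t → Scoped 0 t → openBinder x 0 (lamBind x t) ≡ t
  openBinder-lamBind x t = instantiate-close x

  lamBind-openBinder-zero : ∀ x s → Scoped 0 s → occF x s ≡ 0 → 0 < leadingLams s →
                            lamBind x (openBinder x 0 s) ≡ s
  lamBind-openBinder-zero x (lam t) (lam sc) o _ = cong lam (close-instantiate x o sc)

  trackBinder₁ : ∀ x {s s′} → LocalExchange s s′ → ∀ p → p < leadingLams s →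
                 Σ ℕ λ q → q < leadingLams s′ × Iso (openBinder x p s) (openBinder x q s′)
  trackBinder₁ x (here {u}) zero          p< =
    1 , s≤s (s≤s z≤n) , subst (λ w → Iso (lam (instantiate 1 x u)) (lam w)) (instantiate-suc 0 x u) ε
  trackBinder₁ x (here {u}) (suc zero)    p< =
    0 , s≤s z≤n ,
    subst (λ w → Iso (lam (instantiate 0 x u)) (lam w))
          (trans (cong (instantiate 0 x) (sym (swap-involutive 0 u))) (sym (instantiate-suc 0 x (swap 0 u)))) ε
  trackBinder₁ x (here {u}) (suc (suc p)) (s≤s (s≤s p<)) =
    suc (suc p) , s≤s (s≤s (subst (p <_) (sym (leadingLams-swap 0 u)) p<)) ,
    subst (λ w → Iso (lam (lam (openBinder x p u))) (lam (lam w))) (sym (openBinder-swap x p 0 u)) (here ◅ ε)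
  trackBinder₁ x (lam y)    zero          p< = 0 , s≤s z≤n , (LocalExchange-instantiate 0 x y ◅ ε)
  trackBinder₁ x (lam y)    (suc p)       (s≤s p<) with trackBinder₁ x y p p<
  ... | q , q< , i = suc q , s≤s q< , Iso-lam i

  trackBinder : ∀ x {s s′} → Iso s s′ → ∀ p → p < leadingLams s →
                Σ ℕ λ q → q < leadingLams s′ × Iso (openBinder x p s) (openBinder x q s′)
  trackBinder x ε       p p< = p , p< , ε
  trackBinder x (y ◅ i) p p< with trackBinder₁ x y p p<
  ... | q , q< , i₁ with trackBinder x i q q<
  ...   | r , r< , i₂ = r , r< , Iso-trans i₁ i₂

  bringToFront : ∀ x p s → p < leadingLams s → Σ Tm λ s′ → Iso s s′ × openBinder x 0 s′ ≡ openBinder x p s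
  bringToFront x zero    s       p<       = s , ε , refl
  bringToFront x (suc p) (lam t) (s≤s p<) with bringToFront x p t p<
  ... | t′ , i , e = step t′ i e
    where
    step : ∀ t′ → Iso t t′ → openBinder x 0 t′ ≡ openBinder x p t →
           Σ Tm λ s′ → Iso (lam t) s′ × openBinder x 0 s′ ≡ openBinder x (suc p) (lam t)
    step (lam w) i e =
      lam (lam (swap 0 w)) , Iso-trans (Iso-lam i) (here ◅ ε) ,
      cong lam (trans (instantiate-suc 0 x (swap 0 w)) (trans (cong (instantiate 0 x) (swap-involutive 0 w)) e))
    step (fv a)    i e = ⊥-elim (NP.<⇒≢ (NP.<-≤-trans (s≤s z≤n) p<) (sym (Iso-leadingLams i)))
    step (bv j)    i e = ⊥-elim (NP.<⇒≢ (NP.<-≤-trans (s≤s z≤n) p<) (sym (Iso-leadingLams i)))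
    step (app _ _) i e = ⊥-elim (NP.<⇒≢ (NP.<-≤-trans (s≤s z≤n) p<) (sym (Iso-leadingLams i)))

  lamBind-openBinder : ∀ x p s → Scoped 0 s → occF x s ≡ 0 → p < leadingLams s →
                       Iso (lamBind x (openBinder x p s)) s
  lamBind-openBinder x p s sc o p< with bringToFront x p s p<
  ... | s′ , i , e =
    subst (λ w → Iso (lamBind x w) s) e
      (subst (λ w → Iso w s)
        (sym (lamBind-openBinder-zero x s′ (Iso-Scoped i sc) (trans (sym (Iso-occF x i)) o)
               (subst (0 <_) (Iso-leadingLams i) (NP.<-≤-trans (s≤s z≤n) p<))))
        (Iso-sym i))

  -- Since each λ binds a variable that occurs, the position of the opened
  -- binder can be read off the shape of the result.
  shape-openBinder-deeper : ∀ x q c t → q < leadingLams (lam t) → LamsLinear (lam t) →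
                            shape (instantiate (suc c) x t) ≢ shape (openBinder x q (lam t))
  shape-openBinder-deeper x zero    c t        q<       (lam e l) eq
    with trans (sym e) (shape-instantiate-≢ 0 (suc c) x t (sym eq) λ ())
  ... | ()
  shape-openBinder-deeper x (suc q) c (lam t) (s≤s q<) (lam e l) eq =
    shape-openBinder-deeper x q (suc c) t q< l (lamˢ-injective eq)

  openBinder-shape-injective : ∀ x p q s → p < leadingLams s → q < leadingLams s → LamsLinear s →
                               shape (openBinder x p s) ≡ shape (openBinder x q s) → p ≡ q
  openBinder-shape-injective x zero    zero    s             p<       q<       l         eq = refl
  openBinder-shape-injective x (suc p) (suc q) (lam t)       (s≤s p<) (s≤s q<) (lam e l) eq =
    cong suc (openBinder-shape-injective x p q t p< q< l (lamˢ-injective eq))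
  openBinder-shape-injective x zero    (suc q) (lam (lam t)) p<       (s≤s q<) (lam e l) eq =
    ⊥-elim (shape-openBinder-deeper x q 0 t q< l (lamˢ-injective eq))
  openBinder-shape-injective x (suc p) zero    (lam (lam t)) (s≤s p<) q<       (lam e l) eq =
    ⊥-elim (shape-openBinder-deeper x p 0 t p< l (lamˢ-injective (sym eq)))

module Counting where

  open Syntax
  open import Data.Nat using (_+_; _*_; _∸_)
  open import Data.Nat.Tactic.RingSolver using (solve-∀)
  open import Data.Fin using (splitAt; _↑ˡ_; _↑ʳ_; combine; remQuot; fromℕ<)
  open import Data.Sum using ([_,_]′)
  import Data.Nat.DivMod as DM
  open import Data.Nat.Properties using (_!≢0)
  open import Data.Nat.Induction using (<-rec)
  open import Data.Nat.ListAction using (sum)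
  open import Data.Nat.Combinatorics using (_C_; nCk+nC[k+1]≡[n+1]C[k+1]; k>n⇒nCk≡0)

  NumClasses-≤ : ∀ {P : Tm → Set} {m m′} → NumClasses P m → NumClasses P m′ → m ≤ m′
  NumClasses-≤ {P} {m} {m′} (rep , ok , inj , cov) (rep′ , ok′ , inj′ , cov′) = FP.injective⇒≤ {f = f} f-injective
    where
    f : Fin m → Fin m′
    f i = proj₁ (cov′ (rep i) (ok i))
    f-injective : ∀ {i j} → f i ≡ f j → i ≡ j
    f-injective {i} {j} e =
      inj i j (Iso-trans (proj₂ (cov′ (rep i) (ok i)))
                (subst (λ k → Iso (rep′ k) (rep j)) (sym e) (Iso-sym (proj₂ (cov′ (rep j) (ok j))))))

  NumClasses-unique : ∀ {P : Tm → Set} {m m′} → NumClasses P m → NumClasses P m′ → m ≡ m′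
  NumClasses-unique a b = NP.≤-antisym (NumClasses-≤ a b) (NumClasses-≤ b a)

  NumClasses-⇔ : ∀ {P Q : Tm → Set} {m} → (∀ s → P s → Q s) → (∀ s → Q s → P s) → NumClasses P m → NumClasses Q m
  NumClasses-⇔ P⇒Q Q⇒P (rep , ok , inj , cov) = rep , (λ i → P⇒Q _ (ok i)) , inj , (λ t q → cov t (Q⇒P t q))

  NumClasses-empty : ∀ {P : Tm → Set} → (∀ s → ¬ P s) → NumClasses P 0
  NumClasses-empty ¬P = (λ ()) , (λ ()) , (λ ()) , (λ t p → ⊥-elim (¬P t p))

  NumClasses-zero⇒empty : ∀ {P : Tm → Set} {s} → NumClasses P 0 → ¬ P s
  NumClasses-zero⇒empty {s = s} (rep , ok , inj , cov) p with cov s p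
  ... | () , _

  NumClasses-single : ∀ {P : Tm → Set} t₀ → P t₀ → (∀ s → P s → Iso s t₀) → NumClasses P 1
  NumClasses-single t₀ p₀ all≅t₀ =
    (λ _ → t₀) , (λ _ → p₀) , (λ { F.zero F.zero _ → refl }) , (λ t p → F.zero , all≅t₀ t p)

  NumClasses-⊎ : ∀ {P Q : Tm → Set} {m m′} → NumClasses P m → NumClasses Q m′ →
                 (∀ s s′ → P s → Q s′ → ¬ Iso s s′) → NumClasses (λ s → P s ⊎ Q s) (m + m′)
  NumClasses-⊎ {P} {Q} {m} {m′} (rep , ok , inj , cov) (rep′ , ok′ , inj′ , cov′) apart = R , okR , injR , covR
    where
    R : Fin (m + m′) → Tm
    R k = [ rep , rep′ ]′ (splitAt m k)
    okR : ∀ k → P (R k) ⊎ Q (R k)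
    okR k with splitAt m k
    ... | inj₁ i = inj₁ (ok i)
    ... | inj₂ j = inj₂ (ok′ j)
    injR : ∀ k k′ → Iso (R k) (R k′) → k ≡ k′
    injR k k′ i with splitAt m k in e₁ | splitAt m k′ in e₂
    ... | inj₁ a | inj₁ a′ =
      trans (sym (FP.splitAt⁻¹-↑ˡ e₁)) (trans (cong (_↑ˡ m′) (inj a a′ i)) (FP.splitAt⁻¹-↑ˡ e₂))
    ... | inj₂ b | inj₂ b′ =
      trans (sym (FP.splitAt⁻¹-↑ʳ e₁)) (trans (cong (m ↑ʳ_) (inj′ b b′ i)) (FP.splitAt⁻¹-↑ʳ e₂))
    ... | inj₁ a | inj₂ b′ = ⊥-elim (apart _ _ (ok a) (ok′ b′) i)
    ... | inj₂ b | inj₁ a′ = ⊥-elim (apart _ _ (ok a′) (ok′ b) (Iso-sym i))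
    covR : ∀ t → P t ⊎ Q t → ∃ λ k → Iso t (R k)
    covR t (inj₁ p) with cov t p
    ... | a , i = a ↑ˡ m′ , subst (λ z → Iso t ([ rep , rep′ ]′ z)) (sym (FP.splitAt-↑ˡ m a m′)) i
    covR t (inj₂ q) with cov′ t q
    ... | b , i = m ↑ʳ b , subst (λ z → Iso t ([ rep , rep′ ]′ z)) (sym (FP.splitAt-↑ʳ m m′ b)) i

  AppOf : (Tm → Set) → (Tm → Set) → Tm → Set
  AppOf P Q s = Σ Tm λ t → Σ Tm λ u → s ≡ app t u × P t × Q u

  app-injective : ∀ {a b c d : Tm} → app a b ≡ app c d → a ≡ c × b ≡ d
  app-injective refl = refl , refl

  NumClasses-AppOf : ∀ {P Q : Tm → Set} {m m′} → NumClasses P m → NumClasses Q m′ → NumClasses (AppOf P Q) (m * m′)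
  NumClasses-AppOf {P} {Q} {m} {m′} (rep , ok , inj , cov) (rep′ , ok′ , inj′ , cov′) = R , okR , injR , covR
    where
    R : Fin (m * m′) → Tm
    R k = app (rep (proj₁ (remQuot {m} m′ k))) (rep′ (proj₂ (remQuot {m} m′ k)))
    okR : ∀ k → AppOf P Q (R k)
    okR k = _ , _ , refl , ok _ , ok′ _
    injR : ∀ k k′ → Iso (R k) (R k′) → k ≡ k′
    injR k k′ i with Iso-app⁻¹ i
    ... | _ , _ , refl , it , iu =
      trans (sym (FP.combine-remQuot {m} m′ k))
        (trans (cong₂ combine (inj _ _ it) (inj′ _ _ iu)) (FP.combine-remQuot {m} m′ k′))
    covR : ∀ t → AppOf P Q t → ∃ λ k → Iso t (R k)
    covR t (a , b , refl , pa , qb) with cov a pa | cov′ b qb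
    ... | i , ia | j , jb =
      combine i j ,
      subst (λ z → Iso (app a b) (app (rep (proj₁ z)) (rep′ (proj₂ z)))) (sym (FP.remQuot-combine i j)) (Iso-app ia jb)


  count : ℕ → List ℕ → ℕ
  count a []      = 0
  count a (y ∷ L) = ⟦ a ≡ᵇ y ⟧ + count a L

  Linear : List ℕ → Tm → Set
  Linear L t = Scoped 0 t × LamsLinear t × (∀ a → occF a t ≡ count a L)

  Distinct : List ℕ → Set
  Distinct L = ∀ a → count a L ≤ 1

  LinNeutral : ℕ → List ℕ → Tm → Set
  LinNeutral n L s = Linear L s × Neutral s n

  LinNormal : ℕ → List ℕ → Tm → Set
  LinNormal n L s = Linear L s × Normal s n

  count-head : ∀ y L → 1 ≤ count y (y ∷ L)
  count-head y L rewrite ≡ᵇ-refl y = s≤s z≤n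

  mutual
    Neutral-size-unique : ∀ {t m m′} → Neutral t m → Neutral t m′ → m ≡ m′
    Neutral-size-unique varF        varF          = refl
    Neutral-size-unique varB        varB          = refl
    Neutral-size-unique (app tⁿ uⁿ) (app tⁿ′ uⁿ′) = cong₂ _+_ (Neutral-size-unique tⁿ tⁿ′) (Normal-size-unique uⁿ uⁿ′)

    Normal-size-unique : ∀ {t m m′} → Normal t m → Normal t m′ → m ≡ m′
    Normal-size-unique (neu tⁿ)   (neu tⁿ′)   = cong suc (Neutral-size-unique tⁿ tⁿ′)
    Normal-size-unique (neu ())   (lam _ _)
    Normal-size-unique (lam _ _)  (neu ())
    Normal-size-unique (lam tⁿ _) (lam tⁿ′ _) = Normal-size-unique tⁿ tⁿ′

  Normal-size-positive : ∀ {t m} → Normal t m → 0 < m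
  Normal-size-positive (neu _)    = s≤s z≤n
  Normal-size-positive (lam tⁿ _) = Normal-size-positive tⁿ

  Neutral-leadingLams : ∀ {s m} → Neutral s m → leadingLams s ≡ 0
  Neutral-leadingLams varF      = refl
  Neutral-leadingLams varB      = refl
  Neutral-leadingLams (app _ _) = refl

  varCount : ℕ → ℕ → ℕ
  varCount zero (suc zero) = 1
  varCount _    _          = 0

  LinVar : ℕ → List ℕ → Tm → Set
  LinVar n L s = Σ ℕ λ a → s ≡ fv a × n ≡ 0 × Linear L s

  NumClasses-LinVar : ∀ n L → Distinct L → NumClasses (LinVar n L) (varCount n (length L))
  NumClasses-LinVar (suc n) L           _ = NumClasses-empty λ { s (_ , _ , () , _) }
  NumClasses-LinVar zero    []          _ =
    NumClasses-empty λ { s (a , refl , _ , _ , _ , o) → 1≢0 (trans (sym (cong ⟦_⟧ (≡ᵇ-refl a))) (o a)) }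
    where
    1≢0 : 1 ≢ 0
    1≢0 ()
  NumClasses-LinVar zero    (y ∷ [])    _ =
    NumClasses-single (fv y) (y , refl , refl , fv , fv , λ a → sym (NP.+-identityʳ _)) only-y
    where
    only-y : ∀ s → LinVar zero (y ∷ []) s → Iso s (fv y)
    only-y s (a , refl , _ , _ , _ , o) with ≡ᵇ-cases y a
    ... | inj₁ (refl , _) = ε
    ... | inj₂ (_ , y≠a) with trans (o y) (trans (NP.+-identityʳ _) (cong ⟦_⟧ (≡ᵇ-refl y)))
    ...   | e rewrite y≠a with e
    ...     | ()
  NumClasses-LinVar zero    (y ∷ z ∷ L) distinct = NumClasses-empty not-var
    where
    not-var : ∀ s → ¬ LinVar zero (y ∷ z ∷ L) s
    not-var s (a , refl , _ , _ , _ , o) with ≡ᵇ-cases y a | ≡ᵇ-cases z a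
    ... | inj₂ (_ , y≠a) | _ =
      NP.<⇒≱ (count-head y (z ∷ L)) (NP.≤-reflexive (trans (sym (o y)) (cong ⟦_⟧ y≠a)))
    ... | inj₁ (refl , _) | inj₂ (_ , z≠a) =
      NP.<⇒≱ (NP.≤-trans (count-head z L) (NP.m≤n+m _ ⟦ z ≡ᵇ y ⟧)) (NP.≤-reflexive (trans (sym (o z)) (cong ⟦_⟧ z≠a)))
    ... | inj₁ (refl , _) | inj₁ (refl , _) with distinct y
    ...   | le rewrite ≡ᵇ-refl y = NP.<⇒≱ (s≤s (s≤s z≤n)) (NP.≤-trans (NP.m≤m+n 2 (count y L)) le)

  -- Applications of a neutral term of size a over Sa to a normal term of
  -- size c over Ca, each label of L being added to one of the two sides.
  SplitApp : ℕ → ℕ → List ℕ → List ℕ → List ℕ → Tm → Set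
  SplitApp a c []      Sa Ca s = AppOf (LinNeutral a Sa) (LinNormal c Ca) s
  SplitApp a c (y ∷ L) Sa Ca s = SplitApp a c L (y ∷ Sa) Ca s ⊎ SplitApp a c L Sa (y ∷ Ca) s

  splitCount : (ℕ → ℕ) → (ℕ → ℕ) → ℕ → ℕ → ℕ → ℕ
  splitCount B R zero    s c = B s * R c
  splitCount B R (suc l) s c = splitCount B R l (suc s) c + splitCount B R l s (suc c)

  Distinct3 : List ℕ → List ℕ → List ℕ → Set
  Distinct3 L Sa Ca = ∀ z → count z L + count z Sa + count z Ca ≤ 1

  +-move-to-second : ∀ k l s c → l + (k + s) + c ≡ k + l + s + c
  +-move-to-second = solve-∀

  +-move-to-third : ∀ k l s c → l + s + (k + c) ≡ k + l + s + c
  +-move-to-third = solve-∀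

  Distinct3-to-second : ∀ y L Sa Ca → Distinct3 (y ∷ L) Sa Ca → Distinct3 L (y ∷ Sa) Ca
  Distinct3-to-second y L Sa Ca d z =
    NP.≤-trans (NP.≤-reflexive (+-move-to-second ⟦ z ≡ᵇ y ⟧ (count z L) (count z Sa) (count z Ca))) (d z)

  Distinct3-to-third : ∀ y L Sa Ca → Distinct3 (y ∷ L) Sa Ca → Distinct3 L Sa (y ∷ Ca)
  Distinct3-to-third y L Sa Ca d z =
    NP.≤-trans (NP.≤-reflexive (+-move-to-third ⟦ z ≡ᵇ y ⟧ (count z L) (count z Sa) (count z Ca))) (d z)

  +-split : ∀ {x y p q} → x + y ≡ p + q → p ≤ x → q ≤ y → x ≡ p × y ≡ q
  +-split {x} {y} {p} {q} e p≤x q≤y =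
    NP.≤-antisym (NP.+-cancelʳ-≤ q x p (NP.≤-trans (NP.+-monoʳ-≤ x q≤y) (NP.≤-reflexive e))) p≤x ,
    NP.≤-antisym (NP.+-cancelˡ-≤ p y q (NP.≤-trans (NP.+-monoˡ-≤ y p≤x) (NP.≤-reflexive e))) q≤y

  record AppParts (a c : ℕ) (N : ℕ → ℕ) (s : Tm) : Set where
    constructor parts
    field
      fun arg     : Tm
      s≡app       : s ≡ app fun arg
      fun-scoped  : Scoped 0 fun
      fun-linear  : LamsLinear fun
      fun-neutral : Neutral fun a
      arg-scoped  : Scoped 0 arg
      arg-linear  : LamsLinear arg
      arg-normal  : Normal arg c
      occF-sum    : ∀ z → occF z fun + occF z arg ≡ N z

  SplitApp-parts : ∀ a c L Sa Ca {s} → SplitApp a c L Sa Ca s →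
                   AppParts a c (λ z → count z L + count z Sa + count z Ca) s
  SplitApp-parts a c [] Sa Ca (t , u , refl , ((st , lt , ot) , tⁿ) , ((su , lu , ou) , uⁿ)) =
    parts t u refl st lt tⁿ su lu uⁿ (λ z → cong₂ _+_ (ot z) (ou z))
  SplitApp-parts a c (y ∷ L) Sa Ca (inj₁ p) with SplitApp-parts a c L (y ∷ Sa) Ca p
  ... | parts t u e st lt tⁿ su lu uⁿ o =
    parts t u e st lt tⁿ su lu uⁿ (λ z → trans (o z) (+-move-to-second ⟦ z ≡ᵇ y ⟧ (count z L) (count z Sa) (count z Ca)))
  SplitApp-parts a c (y ∷ L) Sa Ca (inj₂ p) with SplitApp-parts a c L Sa (y ∷ Ca) p
  ... | parts t u e st lt tⁿ su lu uⁿ o =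
    parts t u e st lt tⁿ su lu uⁿ (λ z → trans (o z) (+-move-to-third ⟦ z ≡ᵇ y ⟧ (count z L) (count z Sa) (count z Ca)))

  SplitApp-fun-occurs : ∀ a c L Sa Ca y {s} → SplitApp a c L Sa Ca s → 1 ≤ count y Sa →
                        Σ Tm λ t → Σ Tm λ u → s ≡ app t u × 1 ≤ occF y t
  SplitApp-fun-occurs a c [] Sa Ca y (t , u , refl , ((_ , _ , ot) , _) , _) y∈Sa =
    t , u , refl , subst (1 ≤_) (sym (ot y)) y∈Sa
  SplitApp-fun-occurs a c (z ∷ L) Sa Ca y (inj₁ p) y∈Sa =
    SplitApp-fun-occurs a c L (z ∷ Sa) Ca y p (NP.≤-trans y∈Sa (NP.m≤n+m _ ⟦ y ≡ᵇ z ⟧))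
  SplitApp-fun-occurs a c (z ∷ L) Sa Ca y (inj₂ p) y∈Sa = SplitApp-fun-occurs a c L Sa (z ∷ Ca) y p y∈Sa

  SplitApp-arg-occurs : ∀ a c L Sa Ca y {s} → SplitApp a c L Sa Ca s → 1 ≤ count y Ca →
                        Σ Tm λ t → Σ Tm λ u → s ≡ app t u × 1 ≤ occF y u
  SplitApp-arg-occurs a c [] Sa Ca y (t , u , refl , _ , ((_ , _ , ou) , _)) y∈Ca =
    t , u , refl , subst (1 ≤_) (sym (ou y)) y∈Ca
  SplitApp-arg-occurs a c (z ∷ L) Sa Ca y (inj₁ p) y∈Ca = SplitApp-arg-occurs a c L (z ∷ Sa) Ca y p y∈Ca
  SplitApp-arg-occurs a c (z ∷ L) Sa Ca y (inj₂ p) y∈Ca =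
    SplitApp-arg-occurs a c L Sa (z ∷ Ca) y p (NP.≤-trans y∈Ca (NP.m≤n+m _ ⟦ y ≡ᵇ z ⟧))

  -- Isomorphic terms put each label on the same side of the application,
  -- and a label occurring on both sides would occur twice.
  SplitApp-sides-apart : ∀ a c L Sa Ca y → Distinct3 (y ∷ L) Sa Ca → ∀ s s′ →
                         SplitApp a c L (y ∷ Sa) Ca s → SplitApp a c L Sa (y ∷ Ca) s′ → ¬ Iso s s′
  SplitApp-sides-apart a c L Sa Ca y d s s′ p q i
    with SplitApp-fun-occurs a c L (y ∷ Sa) Ca y p (count-head y Sa)
       | SplitApp-arg-occurs a c L Sa (y ∷ Ca) y q (count-head y Ca)
  ... | t , u , refl , y∈t | t′ , u′ , refl , y∈u′ with Iso-app⁻¹ i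
  ...   | _ , _ , e , t≅ , _ with app-injective e
  ...     | refl , refl with SplitApp-parts a c L Sa (y ∷ Ca) q
  ...       | parts _ _ e′ _ _ _ _ _ _ o with app-injective e′
  ...         | refl , refl =
    NP.<⇒≱ (s≤s (s≤s z≤n))
      (NP.≤-trans (NP.+-mono-≤ (NP.≤-trans y∈t (NP.≤-reflexive (Iso-occF y t≅))) y∈u′)
        (NP.≤-trans (NP.≤-reflexive (trans (o y) (+-move-to-third ⟦ y ≡ᵇ y ⟧ (count y L) (count y Sa) (count y Ca)))) (d y)))

  NumClasses-SplitApp : ∀ a c (B R : ℕ → ℕ) →
    (∀ S → Distinct S → NumClasses (LinNeutral a S) (B (length S))) →
    (∀ C → Distinct C → NumClasses (LinNormal c C) (R (length C))) →
    ∀ L Sa Ca → Distinct3 L Sa Ca → NumClasses (SplitApp a c L Sa Ca) (splitCount B R (length L) (length Sa) (length Ca))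
  NumClasses-SplitApp a c B R neutrals normals []      Sa Ca d =
    NumClasses-AppOf (neutrals Sa (λ z → NP.≤-trans (NP.m≤m+n _ _) (d z)))
                     (normals Ca (λ z → NP.≤-trans (NP.m≤n+m _ _) (d z)))
  NumClasses-SplitApp a c B R neutrals normals (y ∷ L) Sa Ca d =
    NumClasses-⊎ (NumClasses-SplitApp a c B R neutrals normals L (y ∷ Sa) Ca (Distinct3-to-second y L Sa Ca d))
                 (NumClasses-SplitApp a c B R neutrals normals L Sa (y ∷ Ca) (Distinct3-to-third y L Sa Ca d))
                 (SplitApp-sides-apart a c L Sa Ca y d)

  count-rest-zero : ∀ l s c → suc l + s + c ≤ 1 → s ≡ 0 × c ≡ 0
  count-rest-zero l s c (s≤s p) with NP.n≤0⇒n≡0 p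
  ... | e = NP.m+n≡0⇒n≡0 l (NP.m+n≡0⇒m≡0 _ e) , NP.m+n≡0⇒n≡0 (l + s) e

  -- Every application of the right kind is reached by sending each label
  -- of L to the side where it occurs.
  SplitApp-intro : ∀ a c L Sa Ca {t u} → Scoped 0 t → LamsLinear t → Neutral t a →
    Scoped 0 u → LamsLinear u → Normal u c →
    (∀ z → occF z t + occF z u ≡ count z L + count z Sa + count z Ca) →
    (∀ z → count z Sa ≤ occF z t) → (∀ z → count z Ca ≤ occF z u) → Distinct3 L Sa Ca →
    SplitApp a c L Sa Ca (app t u)
  SplitApp-intro a c [] Sa Ca {t} {u} st lt tⁿ su lu uⁿ o Sa⊆t Ca⊆u d =
    t , u , refl , ((st , lt , λ z → proj₁ (split z)) , tⁿ) , ((su , lu , λ z → proj₂ (split z)) , uⁿ)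
    where
    split : ∀ z → occF z t ≡ count z Sa × occF z u ≡ count z Ca
    split z = +-split (o z) (Sa⊆t z) (Ca⊆u z)
  SplitApp-intro a c (y ∷ L) Sa Ca {t} {u} st lt tⁿ su lu uⁿ o Sa⊆t Ca⊆u d
    with count-rest-zero (count y L) (count y Sa) (count y Ca)
           (subst (λ w → w + count y L + count y Sa + count y Ca ≤ 1) (cong ⟦_⟧ (≡ᵇ-refl y)) (d y))
  ... | y∉Sa , y∉Ca with occF y t NP.≟ 0
  ... | yes y∉t = inj₂ (SplitApp-intro a c L Sa (y ∷ Ca) st lt tⁿ su lu uⁿ o′ Sa⊆t Ca⊆u′ (Distinct3-to-third y L Sa Ca d))
    where
    o′ : ∀ z → occF z t + occF z u ≡ count z L + count z Sa + count z (y ∷ Ca)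
    o′ z = trans (o z) (sym (+-move-to-third ⟦ z ≡ᵇ y ⟧ (count z L) (count z Sa) (count z Ca)))
    Ca⊆u′ : ∀ z → count z (y ∷ Ca) ≤ occF z u
    Ca⊆u′ z with ≡ᵇ-cases z y
    ... | inj₂ (_ , z≠y) rewrite z≠y = Ca⊆u z
    ... | inj₁ (refl , z=y) rewrite z=y | y∉Ca =
      subst (1 ≤_) (cong (_+ occF z u) y∉t)
        (subst (1 ≤_) (sym (o z)) (NP.≤-trans (NP.≤-trans (count-head z L) (NP.m≤m+n _ _)) (NP.m≤m+n _ _)))
  ... | no y∈t = inj₁ (SplitApp-intro a c L (y ∷ Sa) Ca st lt tⁿ su lu uⁿ o′ Sa⊆t′ Ca⊆u (Distinct3-to-second y L Sa Ca d))
    where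
    o′ : ∀ z → occF z t + occF z u ≡ count z L + count z (y ∷ Sa) + count z Ca
    o′ z = trans (o z) (sym (+-move-to-second ⟦ z ≡ᵇ y ⟧ (count z L) (count z Sa) (count z Ca)))
    Sa⊆t′ : ∀ z → count z (y ∷ Sa) ≤ occF z t
    Sa⊆t′ z with ≡ᵇ-cases z y
    ... | inj₂ (_ , z≠y) rewrite z≠y = Sa⊆t z
    ... | inj₁ (refl , z=y) rewrite z=y | y∉Sa = NP.n≢0⇒n>0 y∈t

  -- Applications of size n whose function part has size below a.
  AppUpTo : ℕ → ℕ → List ℕ → Tm → Set
  AppUpTo n zero    L s = ⊥
  AppUpTo n (suc a) L s = AppUpTo n a L s ⊎ SplitApp a (n ∸ a) L [] [] s

  appCount : (ℕ → ℕ → ℕ) → (ℕ → ℕ → ℕ) → ℕ → ℕ → ℕ → ℕ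
  appCount B R n zero    k = 0
  appCount B R n (suc a) k = appCount B R n a k + splitCount (B a) (R (n ∸ a)) k 0 0

  Distinct⇒Distinct3 : ∀ L → Distinct L → Distinct3 L [] []
  Distinct⇒Distinct3 L d z = subst (_≤ 1) (sym (trans (NP.+-identityʳ _) (NP.+-identityʳ _))) (d z)

  AppUpTo-fun-size : ∀ n a L {s} → AppUpTo n a L s →
                     Σ Tm λ t → Σ Tm λ u → Σ ℕ λ a′ → s ≡ app t u × Neutral t a′ × a′ < a
  AppUpTo-fun-size n (suc a) L (inj₁ p) with AppUpTo-fun-size n a L p
  ... | t , u , a′ , e , tⁿ , a′<a = t , u , a′ , e , tⁿ , NP.m≤n⇒m≤1+n a′<a
  AppUpTo-fun-size n (suc a) L (inj₂ p) with SplitApp-parts a (n ∸ a) L [] [] p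
  ... | parts t u e _ _ tⁿ _ _ _ _ = t , u , a , e , tⁿ , NP.≤-refl

  NumClasses-AppUpTo : ∀ n (B R : ℕ → ℕ → ℕ) →
    (∀ a → a < n → ∀ S → Distinct S → NumClasses (LinNeutral a S) (B a (length S))) →
    (∀ a → a < n → ∀ C → Distinct C → NumClasses (LinNormal (n ∸ a) C) (R (n ∸ a) (length C))) →
    ∀ a → a ≤ n → ∀ L → Distinct L → NumClasses (AppUpTo n a L) (appCount B R n a (length L))
  NumClasses-AppUpTo n B R neutrals normals zero    a≤n L d = NumClasses-empty λ s ()
  NumClasses-AppUpTo n B R neutrals normals (suc a) a<n L d =
    NumClasses-⊎ (NumClasses-AppUpTo n B R neutrals normals a (NP.<⇒≤ a<n) L d)
                 (NumClasses-SplitApp a (n ∸ a) (B a) (R (n ∸ a)) (neutrals a a<n) (normals a a<n) L [] []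
                   (Distinct⇒Distinct3 L d))
                 apart
    where
    apart : ∀ s s′ → AppUpTo n a L s → SplitApp a (n ∸ a) L [] [] s′ → ¬ Iso s s′
    apart s s′ p q i with AppUpTo-fun-size n a L p | SplitApp-parts a (n ∸ a) L [] [] q
    ... | t , u , a′ , refl , tⁿ , a′<a | parts t′ u′ refl _ _ tⁿ′ _ _ _ _ with Iso-app⁻¹ i
    ...   | _ , _ , e , t≅t′ , _ with app-injective e
    ...     | refl , refl = NP.<⇒≢ a′<a (Neutral-size-unique (Iso-Neutral t≅t′ tⁿ) tⁿ′)

  AppUpTo-intro : ∀ n N a L {s} → a < N → SplitApp a (n ∸ a) L [] [] s → AppUpTo n N L s
  AppUpTo-intro n (suc N) a L a<N p with NP.m≤n⇒m<n∨m≡n (NP.≤-pred a<N)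
  ... | inj₁ a<N′ = inj₁ (AppUpTo-intro n N a L a<N′ p)
  ... | inj₂ refl = inj₂ p

  AppUpTo-elim : ∀ n N L {s} → AppUpTo n N L s → Σ ℕ λ a → a < N × SplitApp a (n ∸ a) L [] [] s
  AppUpTo-elim n (suc N) L (inj₁ p) with AppUpTo-elim n N L p
  ... | a , a<N , q = a , NP.m≤n⇒m≤1+n a<N , q
  AppUpTo-elim n (suc N) L (inj₂ p) = N , NP.≤-refl , p

  LinNeutral-from-cases : ∀ n L s → LinVar n L s ⊎ AppUpTo n n L s → LinNeutral n L s
  LinNeutral-from-cases n L s (inj₁ (a , refl , refl , lin)) = lin , varF
  LinNeutral-from-cases n L s (inj₂ p) with AppUpTo-elim n n L p
  ... | a , a<n , q with SplitApp-parts a (n ∸ a) L [] [] q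
  ...   | parts t u refl st lt tⁿ su lu uⁿ o =
    (app st su , app lt lu , λ z → trans (o z) (trans (NP.+-identityʳ _) (NP.+-identityʳ _))) ,
    subst (Neutral (app t u)) (NP.m+[n∸m]≡n (NP.<⇒≤ a<n)) (app tⁿ uⁿ)

  LinNeutral-cases : ∀ n L s → Distinct L → LinNeutral n L s → LinVar n L s ⊎ AppUpTo n n L s
  LinNeutral-cases .0 L (fv a) d (lin , varF) = inj₁ (a , refl , refl , lin)
  LinNeutral-cases .0 L (bv i) d ((bv () , _) , varB)
  LinNeutral-cases .(m + p) L (app t u) d ((app st su , app lt lu , o) , app {m = m} {p = p} tⁿ uⁿ) =
    inj₂ (AppUpTo-intro (m + p) (m + p) m L (NP.m<m+n m (Normal-size-positive uⁿ))
           (SplitApp-intro m (m + p ∸ m) L [] [] st lt tⁿ su lu (subst (Normal u) (sym (NP.m+n∸m≡n m p)) uⁿ)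
             (λ z → trans (o z) (sym (trans (NP.+-identityʳ _) (NP.+-identityʳ _))))
             (λ z → z≤n) (λ z → z≤n) (Distinct⇒Distinct3 L d)))

  NumClasses-LinNeutral : ∀ n (B R : ℕ → ℕ → ℕ) →
    (∀ a → a < n → ∀ S → Distinct S → NumClasses (LinNeutral a S) (B a (length S))) →
    (∀ a → a < n → ∀ C → Distinct C → NumClasses (LinNormal (n ∸ a) C) (R (n ∸ a) (length C))) →
    ∀ L → Distinct L → NumClasses (LinNeutral n L) (varCount n (length L) + appCount B R n n (length L))
  NumClasses-LinNeutral n B R neutrals normals L d =
    NumClasses-⇔ (LinNeutral-from-cases n L) (λ s → LinNeutral-cases n L s d)
      (NumClasses-⊎ (NumClasses-LinVar n L d) (NumClasses-AppUpTo n B R neutrals normals n NP.≤-refl L d) apart)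
    where
    apart : ∀ s s′ → LinVar n L s → AppUpTo n n L s′ → ¬ Iso s s′
    apart s s′ (a , refl , _) q i with AppUpTo-fun-size n n L q
    ... | _ , _ , _ , refl , _ with Iso-fv⁻¹ i
    ...   | ()


  record NormalLams (n : ℕ) (L : List ℕ) (i : ℕ) (s : Tm) : Set where
    constructor normalLams
    field
      linNormal : LinNormal (suc n) L s
      lams      : leadingLams s ≡ i

  NormalLams-Scoped : ∀ {n L i s} → NormalLams n L i s → Scoped 0 s
  NormalLams-Scoped (normalLams ((sc , _) , _) _) = sc

  NormalLams-LamsLinear : ∀ {n L i s} → NormalLams n L i s → LamsLinear s
  NormalLams-LamsLinear (normalLams ((_ , l , _) , _) _) = l

  NormalLams-occF : ∀ {n L i s} → NormalLams n L i s → ∀ a → occF a s ≡ count a L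
  NormalLams-occF (normalLams ((_ , _ , o) , _) _) = o

  NormalLams-lamBind : ∀ n L i x → count x L ≡ 0 → ∀ t → NormalLams n (x ∷ L) i t → NormalLams n L (suc i) (lamBind x t)
  NormalLams-lamBind n L i x x∉L t (normalLams ((sc , l , o) , tⁿ) lams) =
    normalLams ((lam (Scoped-close x sc) , lam bound-once (LamsLinear-close x 0 l) , occ) ,
     lam (Normal-close x 0 tⁿ) (subst (0 <_) (sym bound-once) (s≤s z≤n)))
    (cong suc (trans (leadingLams-close x 0 t) lams))
    where
    x-once : occF x t ≡ 1
    x-once = trans (o x) (trans (cong (_+ count x L) (cong ⟦_⟧ (≡ᵇ-refl x))) (cong suc x∉L))
    bound-once : occB 0 (close x 0 t) ≡ 1
    bound-once = trans (occB-close 0 x 0 t) (cong₂ _+_ (Scoped-occB 0 sc z≤n) (trans (NP.*-identityˡ _) x-once))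
    occ : ∀ a → occF a (close x 0 t) ≡ count a L
    occ a with ≡ᵇ-cases a x
    ... | inj₁ (refl , a=x) rewrite occF-close a a 0 t | a=x = sym x∉L
    ... | inj₂ (_ , a≠x)    rewrite occF-close a x 0 t | a≠x = trans (o a) (cong (λ b → ⟦ b ⟧ + count a L) a≠x)

  NormalLams-openBinder : ∀ n L i x s p → p < suc i → NormalLams n L (suc i) s → NormalLams n (x ∷ L) i (openBinder x p s)
  NormalLams-openBinder n L i x s p p<i (normalLams ((sc , l , o) , sⁿ) lams) =
    normalLams ((Scoped-openBinder x p s sc , LamsLinear-openBinder x p s l ,
      λ a → trans (occF-openBinder a x p s p< l) (trans (cong (_+ ⟦ a ≡ᵇ x ⟧) (o a)) (NP.+-comm (count a L) ⟦ a ≡ᵇ x ⟧))) ,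
     Normal-openBinder x p s sⁿ)
    (NP.suc-injective (trans (leadingLams-openBinder x p s p<) lams))
    where
    p< : p < leadingLams s
    p< = subst (p <_) (sym lams) p<i

  Enumeration : ∀ {M} (P : Fin M → Set) → Set
  Enumeration {M} P = Σ ℕ λ m → Σ (Fin m → Fin M) λ e →
    (∀ c c′ → e c ≡ e c′ → c ≡ c′) × (∀ c → P (e c)) × (∀ j → P j → ∃ λ c → e c ≡ j)

  enumerate : ∀ M (P : Fin M → Set) → (∀ j → Dec (P j)) → Enumeration P
  enumerate zero    P P? = 0 , (λ ()) , (λ ()) , (λ ()) , (λ ())
  enumerate (suc M) P P? with enumerate M (P ∘ F.suc) (P? ∘ F.suc) | P? F.zero
  ... | m , e , inj , sound , complete | yes P0 = suc m , e′ , inj′ , sound′ , complete′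
    where
    e′ : Fin (suc m) → Fin (suc M)
    e′ F.zero    = F.zero
    e′ (F.suc c) = F.suc (e c)
    inj′ : ∀ c c′ → e′ c ≡ e′ c′ → c ≡ c′
    inj′ F.zero    F.zero     _  = refl
    inj′ F.zero    (F.suc c′) ()
    inj′ (F.suc c) F.zero     ()
    inj′ (F.suc c) (F.suc c′) eq = cong F.suc (inj c c′ (FP.suc-injective eq))
    sound′ : ∀ c → P (e′ c)
    sound′ F.zero    = P0
    sound′ (F.suc c) = sound c
    complete′ : ∀ j → P j → ∃ λ c → e′ c ≡ j
    complete′ F.zero    _ = F.zero , refl
    complete′ (F.suc j) p with complete j p
    ... | c , eq = F.suc c , cong F.suc eq
  ... | m , e , inj , sound , complete | no ¬P0 =
    m , F.suc ∘ e , (λ c c′ eq → inj c c′ (FP.suc-injective eq)) , sound , complete′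
    where
    complete′ : ∀ j → P j → ∃ λ c → F.suc (e c) ≡ j
    complete′ F.zero    p = ⊥-elim (¬P0 p)
    complete′ (F.suc j) p with complete j p
    ... | c , eq = c , cong F.suc eq

  argmin : ∀ {M} i (f : Fin (suc i) → Fin M) → Σ (Fin (suc i)) λ p → ∀ q → toℕ (f p) ≤ toℕ (f q)
  argmin zero    f = F.zero , λ { F.zero → NP.≤-refl }
  argmin (suc i) f with argmin i (f ∘ F.suc)
  ... | p , min with toℕ (f F.zero) NP.≤? toℕ (f (F.suc p))
  ... | yes f0≤ = F.zero  , λ { F.zero → NP.≤-refl ; (F.suc q) → NP.≤-trans f0≤ (min q) }
  ... | no  f0≰ = F.suc p , λ { F.zero → NP.<⇒≤ (NP.≰⇒> f0≰) ; (F.suc q) → min q }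

  -- Given representatives of the classes with i leading λ's over x ∷ L,
  -- we build representatives of the classes with i + 1 leading λ's over L
  -- (one per class of abstractions λx.t, namely the one with smallest
  -- index), and show that opening any of the i + 1 leading binders of
  -- those yields the classes over x ∷ L, each exactly once.
  module Fibre (n : ℕ) (L : List ℕ) (i x : ℕ) (x∉L : count x L ≡ 0) (M : ℕ)
    (rep : Fin M → Tm) (ok : ∀ j → NormalLams n (x ∷ L) i (rep j))
    (inj : ∀ j j′ → Iso (rep j) (rep j′) → j ≡ j′)
    (cov : ∀ t → NormalLams n (x ∷ L) i t → ∃ λ k → Iso t (rep k)) where

    bound : Fin M → Tm
    bound j = lamBind x (rep j)

    bound-ok : ∀ j → NormalLams n L (suc i) (bound j)
    bound-ok j = NormalLams-lamBind n L i x x∉L (rep j) (ok j)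

    x-fresh : ∀ {s} → NormalLams n L (suc i) s → occF x s ≡ 0
    x-fresh s-ok = trans (NormalLams-occF s-ok x) x∉L

    position< : ∀ {s} (p : Fin (suc i)) → NormalLams n L (suc i) s → toℕ p < leadingLams s
    position< p (normalLams _ lams) = subst (toℕ p <_) (sym lams) (FP.toℕ<n p)

    opening : ∀ j (p : Fin (suc i)) → ∃ λ k → Iso (openBinder x (toℕ p) (bound j)) (rep k)
    opening j p = cov _ (NormalLams-openBinder n L i x (bound j) (toℕ p) (FP.toℕ<n p) (bound-ok j))

    opened : Fin M → Fin (suc i) → Fin M
    opened j p = proj₁ (opening j p)

    SameBound : Fin M → Fin M → Set
    SameBound j j′ = Iso (bound j) (bound j′)

    opened-sameBound : ∀ j p → SameBound (opened j p) j
    opened-sameBound j p =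
      Iso-trans (Iso-lam (Iso-close x 0 (Iso-sym (proj₂ (opening j p)))))
        (lamBind-openBinder x (toℕ p) (bound j) (NormalLams-Scoped (bound-ok j)) (x-fresh (bound-ok j)) (position< p (bound-ok j)))

    sameBound-opened : ∀ j j′ → SameBound j j′ → ∃ λ p → opened j′ p ≡ j
    sameBound-opened j j′ r with trackBinder x r 0 (s≤s z≤n)
    ... | q , q<lams , opened≅ =
      p , sym (inj j (opened j′ p)
            (Iso-trans (subst (λ w → Iso w (openBinder x q (bound j′))) (openBinder-lamBind x (rep j) (NormalLams-Scoped (ok j))) opened≅)
               (subst (λ w → Iso (openBinder x w (bound j′)) (rep (opened j′ p))) (FP.toℕ-fromℕ< q<) (proj₂ (opening j′ p)))))
      where
      q< : q < suc i
      q< = subst (q <_) (NormalLams.lams (bound-ok j′)) q<lams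
      p : Fin (suc i)
      p = fromℕ< q<

    Canonical : Fin M → Set
    Canonical j = ∀ p → toℕ j ≤ toℕ (opened j p)

    opaque
      minPosition : Fin M → Fin (suc i)
      minPosition j = proj₁ (argmin i (opened j))

      minPosition-minimal : ∀ j q → toℕ (opened j (minPosition j)) ≤ toℕ (opened j q)
      minPosition-minimal j = proj₂ (argmin i (opened j))

    canonical : Fin M → Fin M
    canonical j = opened j (minPosition j)

    canonical-sameBound : ∀ j → SameBound (canonical j) j
    canonical-sameBound j = opened-sameBound j (minPosition j)

    canonical-Canonical : ∀ j → Canonical (canonical j)
    canonical-Canonical j p = subst (λ w → toℕ (canonical j) ≤ toℕ w) (proj₂ back) (minPosition-minimal j (proj₁ back))
      where
      back : ∃ λ q → opened j q ≡ opened (canonical j) p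
      back = sameBound-opened (opened (canonical j) p) j
               (Iso-trans (opened-sameBound (canonical j) p) (canonical-sameBound j))

    Canonical-unique : ∀ j j′ → Canonical j → Canonical j′ → SameBound j j′ → j ≡ j′
    Canonical-unique j j′ cj cj′ r with sameBound-opened j j′ r | sameBound-opened j′ j (Iso-sym r)
    ... | p , e | p′ , e′ = FP.toℕ-injective (NP.≤-antisym
            (subst (λ w → toℕ j ≤ toℕ w) e′ (cj p′)) (subst (λ w → toℕ j′ ≤ toℕ w) e (cj′ p)))

    canonicals : Enumeration Canonical
    canonicals = enumerate M Canonical (λ j → FP.all? (λ p → toℕ j NP.≤? toℕ (opened j p)))

    m : ℕ
    m = proj₁ canonicals

    canon : Fin m → Fin M
    canon = proj₁ (proj₂ canonicals)

    canon-injective : ∀ c c′ → canon c ≡ canon c′ → c ≡ c′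
    canon-injective = proj₁ (proj₂ (proj₂ canonicals))

    canon-Canonical : ∀ c → Canonical (canon c)
    canon-Canonical = proj₁ (proj₂ (proj₂ (proj₂ canonicals)))

    canon-complete : ∀ j → Canonical j → ∃ λ c → canon c ≡ j
    canon-complete = proj₂ (proj₂ (proj₂ (proj₂ canonicals)))

    canon-unique : ∀ c c′ → SameBound (canon c) (canon c′) → c ≡ c′
    canon-unique c c′ r = canon-injective c c′ (Canonical-unique _ _ (canon-Canonical c) (canon-Canonical c′) r)

    -- the canonical class of the abstractions λx.t for t in class k
    canonOf : Fin M → Fin m
    canonOf k = proj₁ (canon-complete (canonical k) (canonical-Canonical k))

    canonOf-sameBound : ∀ k → SameBound k (canon (canonOf k))
    canonOf-sameBound k =
      subst (SameBound k) (sym (proj₂ (canon-complete (canonical k) (canonical-Canonical k)))) (Iso-sym (canonical-sameBound k))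

    boundClasses : NumClasses (NormalLams n L (suc i)) m
    boundClasses = (bound ∘ canon) , (bound-ok ∘ canon) , canon-unique , covers
      where
      covers : ∀ s → NormalLams n L (suc i) s → ∃ λ c → Iso s (bound (canon c))
      covers s s-ok = canonOf k ,
        Iso-trans (subst (λ w → Iso w (bound k))
                         (lamBind-openBinder-zero x s (NormalLams-Scoped s-ok) (x-fresh s-ok)
                           (subst (0 <_) (sym (NormalLams.lams s-ok)) (s≤s z≤n)))
                         (Iso-lam (Iso-close x 0 (proj₂ K))))
                  (canonOf-sameBound k)
        where
        K = cov (openBinder x 0 s) (NormalLams-openBinder n L i x s 0 (s≤s z≤n) s-ok)
        k = proj₁ K

    openedRep : Fin (m * suc i) → Tm
    openedRep k = openBinder x (toℕ (proj₂ (remQuot {m} (suc i) k))) (bound (canon (proj₁ (remQuot {m} (suc i) k))))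

    openedClasses : NumClasses (NormalLams n (x ∷ L) i) (m * suc i)
    openedClasses = openedRep , ok′ , inj′ , covers
      where
      ok′ : ∀ k → NormalLams n (x ∷ L) i (openedRep k)
      ok′ k = NormalLams-openBinder n L i x _ _ (FP.toℕ<n (proj₂ (remQuot {m} (suc i) k))) (bound-ok _)
      inj′ : ∀ k k′ → Iso (openedRep k) (openedRep k′) → k ≡ k′
      inj′ k k′ r = trans (sym (FP.combine-remQuot {m} (suc i) k))
                      (trans (cong₂ combine c≡c′ p≡p′) (FP.combine-remQuot {m} (suc i) k′))
        where
        c  = proj₁ (remQuot {m} (suc i) k)
        p  = proj₂ (remQuot {m} (suc i) k)
        c′ = proj₁ (remQuot {m} (suc i) k′)
        p′ = proj₂ (remQuot {m} (suc i) k′)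
        lam-once : ∀ c (p : Fin (suc i)) → Iso (lamBind x (openBinder x (toℕ p) (bound (canon c)))) (bound (canon c))
        lam-once c p = lamBind-openBinder x (toℕ p) (bound (canon c)) (NormalLams-Scoped (bound-ok _))
                         (x-fresh (bound-ok _)) (position< p (bound-ok _))
        c≡c′ : c ≡ c′
        c≡c′ = canon-unique c c′ (Iso-trans (Iso-sym (lam-once c p)) (Iso-trans (Iso-lam (Iso-close x 0 r)) (lam-once c′ p′)))
        p≡p′ : p ≡ p′
        p≡p′ = FP.toℕ-injective (openBinder-shape-injective x (toℕ p) (toℕ p′) (bound (canon c))
                 (position< p (bound-ok _)) (position< p′ (bound-ok _)) (NormalLams-LamsLinear (bound-ok _))
                 (Iso-shape (subst (λ w → Iso (openedRep k) (openBinder x (toℕ p′) (bound (canon w)))) (sym c≡c′) r)))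
      covers : ∀ t → NormalLams n (x ∷ L) i t → ∃ λ k → Iso t (openedRep k)
      covers t t-ok =
        combine c p ,
        subst (λ z → Iso t (openBinder x (toℕ (proj₂ z)) (bound (canon (proj₁ z))))) (sym (FP.remQuot-combine c p))
          (subst (λ w → Iso t (openBinder x w (bound (canon c)))) (sym (FP.toℕ-fromℕ< q<))
            (Iso-trans t≅k (subst (λ w → Iso w (openBinder x q (bound (canon c))))
                             (openBinder-lamBind x (rep k) (NormalLams-Scoped (ok k))) tracked)))
        where
        K = cov t t-ok
        k = proj₁ K
        t≅k = proj₂ K
        c = canonOf k
        T = trackBinder x (canonOf-sameBound k) 0 (s≤s z≤n)
        q = proj₁ T
        tracked = proj₂ (proj₂ T)
        q< : q < suc i
        q< = subst (q <_) (NormalLams.lams (bound-ok (canon c))) (proj₁ (proj₂ T))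
        p : Fin (suc i)
        p = fromℕ< q<

  NormalLams-fibre : ∀ n L i x → count x L ≡ 0 → ∀ M → NumClasses (NormalLams n (x ∷ L) i) M →
                     Σ ℕ λ m → NumClasses (NormalLams n L (suc i)) m × M ≡ m * suc i
  NormalLams-fibre n L i x x∉L M (rep , ok , inj , cov) =
    Fib.m , Fib.boundClasses , NumClasses-unique (rep , ok , inj , cov) Fib.openedClasses
    where
    module Fib = Fibre n L i x x∉L M rep ok inj cov

  sumℕ : ℕ → (ℕ → ℕ) → ℕ
  sumℕ zero    f = 0
  sumℕ (suc N) f = sumℕ N f + f N

  sumℕ-cong : ∀ N f g → (∀ i → i < N → f i ≡ g i) → sumℕ N f ≡ sumℕ N g
  sumℕ-cong zero    f g f≗g = refl
  sumℕ-cong (suc N) f g f≗g = cong₂ _+_ (sumℕ-cong N f g (λ i i<N → f≗g i (NP.m≤n⇒m≤1+n i<N))) (f≗g N NP.≤-refl)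

  sumℕ-zero : ∀ N f → (∀ i → i < N → f i ≡ 0) → sumℕ N f ≡ 0
  sumℕ-zero zero    f f≗0 = refl
  sumℕ-zero (suc N) f f≗0 = cong₂ _+_ (sumℕ-zero N f (λ i i<N → f≗0 i (NP.m≤n⇒m≤1+n i<N))) (f≗0 N NP.≤-refl)

  _/!_ : ℕ → ℕ → ℕ
  x /! i = (x DM./ (i !)) {{i !≢0}}

  0/! : ∀ i → 0 /! i ≡ 0
  0/! i = DM.0/n≡0 (i !) {{i !≢0}}

  -- r (c + 1) k = Σ_{i ≤ c+1} b c (k + i) / i! ; the sum stops at c + 1
  -- because a neutral term of size c has at most c + 1 free variables.
  normalRow : (ℕ → ℕ → ℕ) → ℕ → ℕ → ℕ
  normalRow B zero    k = 0
  normalRow B (suc c) k = sumℕ (suc (suc c)) (λ i → B c (k + i) /! i)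

  neutralRow : (ℕ → ℕ → ℕ) → ℕ → ℕ → ℕ
  neutralRow B n k = varCount n k + appCount B (normalRow B) n n k

  -- Course-of-values recursion: rows 0, …, N of the neutral counts, row n
  -- using only rows below n.
  neutralCountUpTo : ℕ → ℕ → ℕ → ℕ
  neutralCountUpTo zero    a k = neutralRow (λ _ _ → 0) 0 k
  neutralCountUpTo (suc N) a k with a NP.≤? N
  ... | yes _ = neutralCountUpTo N a k
  ... | no  _ = neutralRow (neutralCountUpTo N) (suc N) k

  neutralCount : ℕ → ℕ → ℕ
  neutralCount n = neutralCountUpTo n n

  normalCount : ℕ → ℕ → ℕ
  normalCount = normalRow neutralCount

  neutralCount-suc : ∀ N k → neutralCount (suc N) k ≡ neutralRow (neutralCountUpTo N) (suc N) k
  neutralCount-suc N k with suc N NP.≤? N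
  ... | yes N<N = ⊥-elim (NP.<-irrefl refl N<N)
  ... | no  _   = refl

  neutralCountUpTo-stable : ∀ N a k → a ≤ N → neutralCountUpTo N a k ≡ neutralCount a k
  neutralCountUpTo-stable zero    zero k a≤N = refl
  neutralCountUpTo-stable (suc N) a    k a≤N with a NP.≤? N
  ... | yes a≤N′ = neutralCountUpTo-stable N a k a≤N′
  ... | no  a≰N′ rewrite NP.≤∧≮⇒≡ a≤N (a≰N′ ∘ NP.≤-pred) = sym (neutralCount-suc N k)

  splitCount-cong : ∀ (B B′ R R′ : ℕ → ℕ) → (∀ j → B j ≡ B′ j) → (∀ j → R j ≡ R′ j) →
                    ∀ l s c → splitCount B R l s c ≡ splitCount B′ R′ l s c
  splitCount-cong B B′ R R′ B≗ R≗ zero    s c = cong₂ _*_ (B≗ s) (R≗ c)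
  splitCount-cong B B′ R R′ B≗ R≗ (suc l) s c =
    cong₂ _+_ (splitCount-cong B B′ R R′ B≗ R≗ l (suc s) c) (splitCount-cong B B′ R R′ B≗ R≗ l s (suc c))

  normalRow-cong : ∀ B B′ c → (∀ a → a < c → ∀ k → B a k ≡ B′ a k) → ∀ k → normalRow B c k ≡ normalRow B′ c k
  normalRow-cong B B′ zero    B≗ k = refl
  normalRow-cong B B′ (suc c) B≗ k = sumℕ-cong (suc (suc c)) _ _ (λ i _ → cong (_/! i) (B≗ c NP.≤-refl (k + i)))

  appCount-cong : ∀ B B′ n → (∀ a → a < n → ∀ k → B a k ≡ B′ a k) →
                  ∀ a → a ≤ n → ∀ k → appCount B (normalRow B) n a k ≡ appCount B′ (normalRow B′) n a k
  appCount-cong B B′ n B≗ zero    a≤n k = refl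
  appCount-cong B B′ n B≗ (suc a) a<n k =
    cong₂ _+_ (appCount-cong B B′ n B≗ a (NP.<⇒≤ a<n) k)
      (splitCount-cong _ _ _ _ (B≗ a a<n)
        (normalRow-cong B B′ (n ∸ a) (λ a′ a′<n∸a → B≗ a′ (NP.<-≤-trans a′<n∸a (NP.m∸n≤m n a)))) k 0 0)

  neutralCount-unfold : ∀ n k → neutralCount n k ≡ neutralRow neutralCount n k
  neutralCount-unfold zero    k = refl
  neutralCount-unfold (suc N) k =
    trans (neutralCount-suc N k)
      (cong (varCount (suc N) k +_)
        (appCount-cong (neutralCountUpTo N) neutralCount (suc N)
          (λ a a<N k′ → neutralCountUpTo-stable N a k′ (NP.≤-pred a<N)) (suc N) NP.≤-refl k))

  splitCount-vanishes : ∀ (B R : ℕ → ℕ) K → (∀ p q → p + q ≡ K → B p * R q ≡ 0) →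
                        ∀ l s c → l + s + c ≡ K → splitCount B R l s c ≡ 0
  splitCount-vanishes B R K BR≡0 zero    s c e = BR≡0 s c e
  splitCount-vanishes B R K BR≡0 (suc l) s c e =
    cong₂ _+_ (splitCount-vanishes B R K BR≡0 l (suc s) c (trans (cong (_+ c) (NP.+-suc l s)) e))
              (splitCount-vanishes B R K BR≡0 l s (suc c) (trans (NP.+-suc (l + s) c) e))

  CountsVanish : ℕ → Set
  CountsVanish n = (∀ K → suc n < K → neutralCount n K ≡ 0) × (∀ K → n < K → normalCount n K ≡ 0)

  countsVanish : ∀ n → CountsVanish n
  countsVanish = <-rec CountsVanish step
    where
    step : ∀ n → (∀ {m} → m < n → CountsVanish m) → CountsVanish n
    step n ih = neutral-vanishes , normal-vanishes n NP.≤-refl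
      where
      normal-vanishes : ∀ c → c ≤ n → ∀ K → c < K → normalCount c K ≡ 0
      normal-vanishes zero    _    K _   = refl
      normal-vanishes (suc c) c<n K c<K =
        sumℕ-zero (suc (suc c)) _
          (λ i _ → trans (cong (_/! i) (proj₁ (ih c<n) (K + i) (NP.≤-trans c<K (NP.m≤m+n K i)))) (0/! i))
      neutral-vanishes : ∀ K → suc n < K → neutralCount n K ≡ 0
      neutral-vanishes K n<K = trans (neutralCount-unfold n K) (cong₂ _+_ (var-vanishes n K n<K) (app-vanishes n NP.≤-refl))
        where
        var-vanishes : ∀ n K → suc n < K → varCount n K ≡ 0
        var-vanishes zero    (suc zero)    (s≤s ())
        var-vanishes zero    (suc (suc K)) _ = refl
        var-vanishes (suc n) K             _ = refl
        app-vanishes : ∀ a → a ≤ n → appCount neutralCount normalCount n a K ≡ 0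
        app-vanishes zero    _   = refl
        app-vanishes (suc a) a<n = cong₂ _+_ (app-vanishes a (NP.<⇒≤ a<n))
          (splitCount-vanishes (neutralCount a) (normalCount (n ∸ a)) K product-vanishes K 0 0
            (trans (NP.+-identityʳ _) (NP.+-identityʳ _)))
          where
          product-vanishes : ∀ p q → p + q ≡ K → neutralCount a p * normalCount (n ∸ a) q ≡ 0
          product-vanishes p q p+q≡K with suc a NP.<? p
          ... | yes a<p = cong (_* normalCount (n ∸ a) q) (proj₁ (ih a<n) p a<p)
          ... | no  a≮p = trans (cong (neutralCount a p *_) (normal-vanishes (n ∸ a) (NP.m∸n≤m n a) q n∸a<q))
                                (NP.*-zeroʳ (neutralCount a p))
            where
            n∸a<q : n ∸ a < q
            n∸a<q = NP.+-cancelˡ-< p (n ∸ a) q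
                      (NP.≤-<-trans (NP.+-monoˡ-≤ (n ∸ a) (NP.≮⇒≥ a≮p))
                        (subst (_< p + q) (sym (trans (cong suc (NP.+-comm a (n ∸ a))) (cong suc (NP.m∸n+n≡m (NP.<⇒≤ a<n)))))
                          (subst (suc n <_) (sym p+q≡K) n<K)))

  neutralCount-vanishes : ∀ n K → suc n < K → neutralCount n K ≡ 0
  neutralCount-vanishes n = proj₁ (countsVanish n)


  fresh : List ℕ → ℕ
  fresh L = suc (sum L)

  count-fresh : ∀ L → count (fresh L) L ≡ 0
  count-fresh L = go (fresh L) L NP.≤-refl
    where
    go : ∀ z L → sum L < z → count z L ≡ 0
    go z []      _   = refl
    go z (y ∷ L) y+L<z with ≡ᵇ-cases z y
    ... | inj₁ (refl , _) = ⊥-elim (NP.<⇒≱ y+L<z (NP.m≤m+n z (sum L)))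
    ... | inj₂ (_ , z≠y)  = trans (cong (λ b → ⟦ b ⟧ + count z L) z≠y)
                                  (go z L (NP.≤-<-trans (NP.m≤n+m (sum L) y) y+L<z))

  Distinct-∷ : ∀ x L → count x L ≡ 0 → Distinct L → Distinct (x ∷ L)
  Distinct-∷ x L x∉L d a with ≡ᵇ-cases a x
  ... | inj₁ (refl , a=x) = subst (_≤ 1) (sym (trans (cong (λ b → ⟦ b ⟧ + count a L) a=x) (cong suc x∉L))) NP.≤-refl
  ... | inj₂ (_ , a≠x)    = subst (_≤ 1) (sym (cong (λ b → ⟦ b ⟧ + count a L) a≠x)) (d a)

  NumClasses-NormalLams : ∀ c (B : ℕ → ℕ) → (∀ L → Distinct L → NumClasses (LinNeutral c L) (B (length L))) →
    ∀ i L → Distinct L →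
    NumClasses (NormalLams c L i) (B (length L + i) /! i) × B (length L + i) ≡ (B (length L + i) /! i) * i !
  NumClasses-NormalLams c B neutrals zero L d =
    subst (NumClasses (NormalLams c L 0)) (sym B/0!≡B)
      (NumClasses-⇔ (λ s (lin , sⁿ) → normalLams (lin , neu sⁿ) (Neutral-leadingLams sⁿ)) body (neutrals L d)) ,
    sym (trans (NP.*-identityʳ _) (DM.n/1≡n _))
    where
    B/0!≡B : B (length L + 0) /! 0 ≡ B (length L)
    B/0!≡B = trans (DM.n/1≡n _) (cong B (NP.+-identityʳ _))
    body : ∀ s → NormalLams c L 0 s → LinNeutral c L s
    body s (normalLams (lin , neu sⁿ)   _)  = lin , sⁿ
    body s (normalLams (lin , lam _ _) ())
  NumClasses-NormalLams c B neutrals (suc i) L d =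
    subst (NumClasses (NormalLams c L (suc i))) (sym B/[i+1]!≡m) classes ,
    trans B≡m*[i+1]! (cong (_* (suc i !)) (sym B/[i+1]!≡m))
    where
    k = length L
    x = fresh L
    IH = NumClasses-NormalLams c B neutrals i (x ∷ L) (Distinct-∷ x L (count-fresh L) d)
    fibre = NormalLams-fibre c L i x (count-fresh L) _ (proj₁ IH)
    m = proj₁ fibre
    classes : NumClasses (NormalLams c L (suc i)) m
    classes = proj₁ (proj₂ fibre)
    B≡m*[i+1]! : B (k + suc i) ≡ m * (suc i !)
    B≡m*[i+1]! = begin
      B (k + suc i)                 ≡⟨ cong B (NP.+-suc k i) ⟩
      B (suc k + i)                 ≡⟨ proj₂ IH ⟩
      (B (suc k + i) /! i) * i !    ≡⟨ cong (_* i !) (proj₂ (proj₂ fibre)) ⟩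
      m * suc i * i !               ≡⟨ NP.*-assoc m (suc i) (i !) ⟩
      m * (suc i !)                 ∎
      where open ≡-Reasoning
    B/[i+1]!≡m : B (k + suc i) /! suc i ≡ m
    B/[i+1]!≡m = trans (cong (_/! suc i) B≡m*[i+1]!) (DM.m*n/n≡m m (suc i !) {{suc i !≢0}})

  NormalLamsBelow : ℕ → List ℕ → ℕ → Tm → Set
  NormalLamsBelow c L zero    s = ⊥
  NormalLamsBelow c L (suc N) s = NormalLamsBelow c L N s ⊎ NormalLams c L N s

  NormalLamsBelow-leadingLams : ∀ c L N {s} → NormalLamsBelow c L N s → leadingLams s < N
  NormalLamsBelow-leadingLams c L (suc N) (inj₁ p)                  = NP.m≤n⇒m≤1+n (NormalLamsBelow-leadingLams c L N p)
  NormalLamsBelow-leadingLams c L (suc N) (inj₂ (normalLams _ lams)) = s≤s (NP.≤-reflexive lams)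

  NormalLamsBelow-LinNormal : ∀ c L N {s} → NormalLamsBelow c L N s → LinNormal (suc c) L s
  NormalLamsBelow-LinNormal c L (suc N) (inj₁ p) = NormalLamsBelow-LinNormal c L N p
  NormalLamsBelow-LinNormal c L (suc N) (inj₂ p) = NormalLams.linNormal p

  NormalLamsBelow-intro : ∀ c L N {s} → leadingLams s < N → LinNormal (suc c) L s → NormalLamsBelow c L N s
  NormalLamsBelow-intro c L (suc N) lams<N sⁿ with NP.m≤n⇒m<n∨m≡n (NP.≤-pred lams<N)
  ... | inj₁ lams<N′ = inj₁ (NormalLamsBelow-intro c L N lams<N′ sⁿ)
  ... | inj₂ lams≡N  = inj₂ (normalLams sⁿ lams≡N)

  NumClasses-NormalLamsBelow : ∀ c (B : ℕ → ℕ) → (∀ L → Distinct L → NumClasses (LinNeutral c L) (B (length L))) →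
    ∀ L → Distinct L → ∀ N → NumClasses (NormalLamsBelow c L N) (sumℕ N (λ i → B (length L + i) /! i))
  NumClasses-NormalLamsBelow c B neutrals L d zero    = NumClasses-empty λ s ()
  NumClasses-NormalLamsBelow c B neutrals L d (suc N) =
    NumClasses-⊎ (NumClasses-NormalLamsBelow c B neutrals L d N) (proj₁ (NumClasses-NormalLams c B neutrals N L d))
      (λ s s′ p q s≅s′ → NP.<⇒≢ (NormalLamsBelow-leadingLams c L N p) (trans (Iso-leadingLams s≅s′) (NormalLams.lams q)))

  NumClasses-LinNormal-suc : ∀ c → (∀ L → Distinct L → NumClasses (LinNeutral c L) (neutralCount c (length L))) →
    ∀ L → Distinct L → NumClasses (LinNormal (suc c) L) (normalCount (suc c) (length L))
  NumClasses-LinNormal-suc c neutrals L d =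
    NumClasses-⇔ (λ s → NormalLamsBelow-LinNormal c L _) below
      (NumClasses-NormalLamsBelow c (neutralCount c) neutrals L d (suc (suc c)))
    where
    below : ∀ s → LinNormal (suc c) L s → NormalLamsBelow c L (suc (suc c)) s
    below s sⁿ with leadingLams s NP.<? suc (suc c)
    ... | yes lams<  = NormalLamsBelow-intro c L _ lams< sⁿ
    ... | no  lams≮ = ⊥-elim (NumClasses-zero⇒empty (subst (NumClasses (NormalLams c L (leadingLams s))) no-classes
                                (proj₁ (NumClasses-NormalLams c (neutralCount c) neutrals (leadingLams s) L d)))
                              (normalLams sⁿ refl))
      where
      no-classes : neutralCount c (length L + leadingLams s) /! leadingLams s ≡ 0
      no-classes = trans (cong (_/! leadingLams s)
                            (neutralCount-vanishes c _ (NP.≤-trans (NP.≮⇒≥ lams≮) (NP.m≤n+m (leadingLams s) (length L)))))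
                         (0/! (leadingLams s))

  CountsCorrect : ℕ → Set
  CountsCorrect n = (∀ L → Distinct L → NumClasses (LinNeutral n L) (neutralCount n (length L)))
                  × (∀ L → Distinct L → NumClasses (LinNormal n L) (normalCount n (length L)))

  LinNormal-classes : ∀ n → (∀ {m} → m < n → CountsCorrect m) →
                      ∀ L → Distinct L → NumClasses (LinNormal n L) (normalCount n (length L))
  LinNormal-classes zero    ih L d = NumClasses-empty λ s sⁿ → NP.<⇒≱ (Normal-size-positive (proj₂ sⁿ)) z≤n
  LinNormal-classes (suc c) ih     = NumClasses-LinNormal-suc c (proj₁ (ih NP.≤-refl))

  countsCorrect : ∀ n → CountsCorrect n
  countsCorrect = <-rec CountsCorrect step
    where
    step : ∀ n → (∀ {m} → m < n → CountsCorrect m) → CountsCorrect n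
    step n ih = neutrals , LinNormal-classes n ih
      where
      normals-below : ∀ a → a < n → ∀ C → Distinct C → NumClasses (LinNormal (n ∸ a) C) (normalCount (n ∸ a) (length C))
      normals-below a a<n with NP.m≤n⇒m<n∨m≡n (NP.m∸n≤m n a)
      ... | inj₁ n∸a<n = proj₂ (ih n∸a<n)
      ... | inj₂ n∸a≡n rewrite n∸a≡n = LinNormal-classes n ih
      neutrals : ∀ L → Distinct L → NumClasses (LinNeutral n L) (neutralCount n (length L))
      neutrals L d = subst (NumClasses (LinNeutral n L)) (sym (neutralCount-unfold n (length L)))
        (NumClasses-LinNeutral n neutralCount normalCount (λ a a<n → proj₁ (ih a<n)) normals-below L d)


  count-applyUpTo-suc : ∀ (f : ℕ → ℕ) a k → count (suc a) (applyUpTo (suc ∘ f) k) ≡ count a (applyUpTo f k)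
  count-applyUpTo-suc f a zero    = refl
  count-applyUpTo-suc f a (suc k) = cong (⟦ a ≡ᵇ f 0 ⟧ +_) (count-applyUpTo-suc (f ∘ suc) a k)

  count-zero-applyUpTo-suc : ∀ (f : ℕ → ℕ) k → count 0 (applyUpTo (suc ∘ f) k) ≡ 0
  count-zero-applyUpTo-suc f zero    = refl
  count-zero-applyUpTo-suc f (suc k) = count-zero-applyUpTo-suc (f ∘ suc) k

  count-upTo : ∀ a k → count a (upTo k) ≡ (if a <ᵇ k then 1 else 0)
  count-upTo a       zero    = refl
  count-upTo zero    (suc k) = cong suc (count-zero-applyUpTo-suc (λ i → i) k)
  count-upTo (suc a) (suc k) = trans (count-applyUpTo-suc (λ i → i) a k) (count-upTo a k)

  Distinct-upTo : ∀ k → Distinct (upTo k)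
  Distinct-upTo k a = subst (_≤ 1) (sym (count-upTo a k)) (bit≤1 (a <ᵇ k))
    where
    bit≤1 : ∀ b → ⟦ b ⟧ ≤ 1
    bit≤1 true  = NP.≤-refl
    bit≤1 false = z≤n

  Linear-upTo : ∀ k t → Linear (upTo k) t → LinearK k t
  Linear-upTo k t (sc , l , o) = sc , l , λ a → trans (o a) (count-upTo a k)

  LinearK-upTo : ∀ k t → LinearK k t → Linear (upTo k) t
  LinearK-upTo k t (sc , l , o) = sc , l , λ a → trans (o a) (sym (count-upTo a k))

  countsNeutral : CountsNeutral neutralCount
  countsNeutral n k =
    subst (λ k′ → NumClasses (λ t → LinearK k t × Neutral t n) (neutralCount n k′)) (length-applyUpTo (λ i → i) k)
      (NumClasses-⇔ (λ t (lin , tⁿ) → Linear-upTo k t lin , tⁿ) (λ t (lin , tⁿ) → LinearK-upTo k t lin , tⁿ)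
        (proj₁ (countsCorrect n) (upTo k) (Distinct-upTo k)))

  countsNormal : CountsNormal normalCount
  countsNormal n k =
    subst (λ k′ → NumClasses (λ t → LinearK k t × Normal t n) (normalCount n k′)) (length-applyUpTo (λ i → i) k)
      (NumClasses-⇔ (λ t (lin , tⁿ) → Linear-upTo k t lin , tⁿ) (λ t (lin , tⁿ) → LinearK-upTo k t lin , tⁿ)
        (proj₂ (countsCorrect n) (upTo k) (Distinct-upTo k)))


  sumℕ-suc : ∀ N f → sumℕ (suc N) f ≡ f 0 + sumℕ N (f ∘ suc)
  sumℕ-suc zero    f = NP.+-comm 0 (f 0)
  sumℕ-suc (suc N) f = trans (cong (_+ f (suc N)) (sumℕ-suc N f)) (NP.+-assoc (f 0) _ _)

  sumℕ-+ : ∀ N f g → sumℕ N (λ j → f j + g j) ≡ sumℕ N f + sumℕ N g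
  sumℕ-+ zero    f g = refl
  sumℕ-+ (suc N) f g = trans (cong (_+ (f N + g N)) (sumℕ-+ N f g)) (ℕ+.interchange (sumℕ N f) (sumℕ N g) (f N) (g N))

  -- By Pascal's rule.
  splitCount-binomial : ∀ (B R : ℕ → ℕ) l s c →
                        splitCount B R l s c ≡ sumℕ (suc l) (λ j → (l C j) * B (s + j) * R (c + (l ∸ j)))
  splitCount-binomial B R zero    s c =
    sym (cong₂ _*_ (trans (NP.+-identityʳ _) (cong B (NP.+-identityʳ s))) (cong R (NP.+-identityʳ c)))
  splitCount-binomial B R (suc l) s c = begin
    splitCount B R l (suc s) c + splitCount B R l s (suc c)
      ≡⟨ cong₂ _+_ (splitCount-binomial B R l (suc s) c) (splitCount-binomial B R l s (suc c)) ⟩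
    sumℕ (suc l) left + sumℕ (suc l) right
      ≡⟨ cong (sumℕ (suc l) left +_) right≡ ⟩
    sumℕ (suc l) left + (term 0 + sumℕ (suc l) pascal)
      ≡⟨ ℕ+.x∙yz≈y∙xz (sumℕ (suc l) left) (term 0) _ ⟩
    term 0 + (sumℕ (suc l) left + sumℕ (suc l) pascal)
      ≡⟨ cong (term 0 +_) (sym (trans (sumℕ-cong (suc l) _ _ (λ j _ → term-suc j)) (sumℕ-+ (suc l) _ _))) ⟩
    term 0 + sumℕ (suc l) (term ∘ suc)
      ≡⟨ sym (sumℕ-suc (suc l) term) ⟩
    sumℕ (suc (suc l)) term ∎
    where
    open ≡-Reasoning
    term : ℕ → ℕ
    term j = (suc l C j) * B (s + j) * R (c + (suc l ∸ j))
    left : ℕ → ℕ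
    left j = (l C j) * B (suc s + j) * R (c + (l ∸ j))
    right : ℕ → ℕ
    right j = (l C j) * B (s + j) * R (suc c + (l ∸ j))
    pascal : ℕ → ℕ
    pascal j = (l C suc j) * B (s + suc j) * R (c + (l ∸ j))
    term-suc : ∀ j → term (suc j) ≡ left j + pascal j
    term-suc j = begin
      (suc l C suc j) * B (s + suc j) * R (c + (l ∸ j))
        ≡⟨ cong (λ z → z * B (s + suc j) * R (c + (l ∸ j))) (sym (nCk+nC[k+1]≡[n+1]C[k+1] l j)) ⟩
      ((l C j) + (l C suc j)) * B (s + suc j) * R (c + (l ∸ j))
        ≡⟨ cong (_* R (c + (l ∸ j))) (NP.*-distribʳ-+ (B (s + suc j)) (l C j) (l C suc j)) ⟩
      ((l C j) * B (s + suc j) + (l C suc j) * B (s + suc j)) * R (c + (l ∸ j))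
        ≡⟨ NP.*-distribʳ-+ (R (c + (l ∸ j))) ((l C j) * B (s + suc j)) ((l C suc j) * B (s + suc j)) ⟩
      (l C j) * B (s + suc j) * R (c + (l ∸ j)) + pascal j
        ≡⟨ cong (λ z → (l C j) * B z * R (c + (l ∸ j)) + pascal j) (NP.+-suc s j) ⟩
      left j + pascal j ∎
    right≡ : sumℕ (suc l) right ≡ term 0 + sumℕ (suc l) pascal
    right≡ = begin
      sumℕ (suc l) right
        ≡⟨ sumℕ-suc l right ⟩
      right 0 + sumℕ l (right ∘ suc)
        ≡⟨ cong₂ _+_ (cong (λ z → (B (s + 0) + 0) * R z) (sym (NP.+-suc c l)))
                     (sumℕ-cong l _ _ (λ j j<l → cong (λ z → (l C suc j) * B (s + suc j) * R z)
                        (trans (sym (NP.+-suc c (l ∸ suc j))) (cong (c +_) (sym (NP.+-∸-assoc 1 j<l)))))) ⟩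
      term 0 + sumℕ l pascal
        ≡⟨ cong (term 0 +_) (sym (trans (cong (sumℕ l pascal +_) pascal-last) (NP.+-identityʳ _))) ⟩
      term 0 + sumℕ (suc l) pascal ∎
      where
      pascal-last : pascal l ≡ 0
      pascal-last = cong (λ z → z * B (s + suc l) * R (c + (l ∸ l))) (k>n⇒nCk≡0 (NP.n<1+n l))

  appCount-binomial : ∀ n a k → appCount neutralCount normalCount n a k ≡
                      sumℕ a (λ a′ → sumℕ (suc k) (λ j → (k C j) * neutralCount a′ j * normalCount (n ∸ a′) (k ∸ j)))
  appCount-binomial n zero    k = refl
  appCount-binomial n (suc a) k =
    cong₂ _+_ (appCount-binomial n a k) (splitCount-binomial (neutralCount a) (normalCount (n ∸ a)) k 0 0)

module Series where

  open Counting
  open import Data.Nat using (_∸_; NonZero)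
  open import Data.Nat.Properties using (_!≢0; _!*_!≢0)
  import Data.Nat.DivMod as DM
  open import Data.Nat.Combinatorics using (_C_; nCk≡n!/k![n-k]!; k![n∸k]!∣n!)
  open import Data.Nat.Tactic.RingSolver using (solve-∀)
  import Data.Integer as ℤ
  open import Data.Rational using (ℚ; 0ℚ; 1ℚ; _+_; _*_; _/_; toℚᵘ)
  import Data.Rational.Properties as QP
  import Data.Rational.Unnormalised as U
  import Data.Rational.Unnormalised.Properties as UP
  open import Data.Rational.Solver using (module +-*-Solver)
  open +-*-Solver using (solve; _:*_; _:=_)
  open ≡-Reasoning

  toℚᵘ-ℕ→ℚ : ∀ m → toℚᵘ (ℕ→ℚ m) U.≃ U.mkℚᵘ (ℤ.+ m) 0
  toℚᵘ-ℕ→ℚ m = QP.toℚᵘ-fromℚᵘ (U.mkℚᵘ (ℤ.+ m) 0)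

  ℕ→ℚ-suc : ∀ m → ℕ→ℚ (suc m) ≡ 1ℚ + ℕ→ℚ m
  ℕ→ℚ-suc m = QP.toℚᵘ-injective
    (UP.≃-trans (toℚᵘ-ℕ→ℚ (suc m))
      (UP.≃-sym (UP.≃-trans (QP.toℚᵘ-homo-+ 1ℚ (ℕ→ℚ m)) (UP.≃-trans (UP.+-cong (toℚᵘ-ℕ→ℚ 1) (toℚᵘ-ℕ→ℚ m)) (sum m)))))
    where
    sum : ∀ m → (U.mkℚᵘ (ℤ.+ 1) 0 U.+ U.mkℚᵘ (ℤ.+ m) 0) U.≃ U.mkℚᵘ (ℤ.+ suc m) 0
    sum zero    = U.*≡* refl
    sum (suc m) = U.*≡* (cong (λ z → ℤ.+ suc (suc z)) (NP.*-identityʳ (m ℕ.* 1)))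

  ℕ→ℚ-+ : ∀ a b → ℕ→ℚ (a ℕ.+ b) ≡ ℕ→ℚ a + ℕ→ℚ b
  ℕ→ℚ-+ zero    b = sym (QP.+-identityˡ (ℕ→ℚ b))
  ℕ→ℚ-+ (suc a) b = begin
    ℕ→ℚ (suc (a ℕ.+ b))         ≡⟨ ℕ→ℚ-suc (a ℕ.+ b) ⟩
    1ℚ + ℕ→ℚ (a ℕ.+ b)          ≡⟨ cong (1ℚ +_) (ℕ→ℚ-+ a b) ⟩
    1ℚ + (ℕ→ℚ a + ℕ→ℚ b)        ≡⟨ QP.+-assoc 1ℚ (ℕ→ℚ a) (ℕ→ℚ b) ⟨
    (1ℚ + ℕ→ℚ a) + ℕ→ℚ b        ≡⟨ cong (_+ ℕ→ℚ b) (ℕ→ℚ-suc a) ⟨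
    ℕ→ℚ (suc a) + ℕ→ℚ b         ∎

  ℕ→ℚ-* : ∀ a b → ℕ→ℚ (a ℕ.* b) ≡ ℕ→ℚ a * ℕ→ℚ b
  ℕ→ℚ-* zero    b = sym (QP.*-zeroˡ (ℕ→ℚ b))
  ℕ→ℚ-* (suc a) b = begin
    ℕ→ℚ (b ℕ.+ a ℕ.* b)               ≡⟨ ℕ→ℚ-+ b (a ℕ.* b) ⟩
    ℕ→ℚ b + ℕ→ℚ (a ℕ.* b)             ≡⟨ cong (ℕ→ℚ b +_) (ℕ→ℚ-* a b) ⟩
    ℕ→ℚ b + ℕ→ℚ a * ℕ→ℚ b             ≡⟨ cong (_+ ℕ→ℚ a * ℕ→ℚ b) (QP.*-identityˡ (ℕ→ℚ b)) ⟨
    1ℚ * ℕ→ℚ b + ℕ→ℚ a * ℕ→ℚ b        ≡⟨ QP.*-distribʳ-+ (ℕ→ℚ b) 1ℚ (ℕ→ℚ a) ⟨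
    (1ℚ + ℕ→ℚ a) * ℕ→ℚ b              ≡⟨ cong (_* ℕ→ℚ b) (ℕ→ℚ-suc a) ⟨
    ℕ→ℚ (suc a) * ℕ→ℚ b               ∎

  ℕ→ℚ-*-1/ : ∀ d .{{_ : NonZero d}} → ℕ→ℚ d * ((ℤ.+ 1) / d) ≡ 1ℚ
  ℕ→ℚ-*-1/ (suc d) = QP.toℚᵘ-injective
    (UP.≃-trans (QP.toℚᵘ-homo-* (ℕ→ℚ (suc d)) ((ℤ.+ 1) / suc d))
      (UP.≃-trans (UP.*-cong (toℚᵘ-ℕ→ℚ (suc d)) (QP.toℚᵘ-fromℚᵘ (U.mkℚᵘ (ℤ.+ 1) d)))
        (U.*≡* (cong (λ z → ℤ.+ suc z) (cross d)))))
    where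
    cross : ∀ d → d ℕ.* 1 ℕ.* 1 ≡ d ℕ.+ 0 ℕ.* suc d ℕ.+ 0 ℕ.* suc (d ℕ.+ 0 ℕ.* suc d)
    cross = solve-∀

  ℕ→ℚ-!-*-inv! : ∀ i → ℕ→ℚ (i !) * inv! i ≡ 1ℚ
  ℕ→ℚ-!-*-inv! i = ℕ→ℚ-*-1/ (i !) {{i !≢0}}

  sumQ-cong : ∀ N f g → (∀ i → i < N → f i ≡ g i) → sumQ N f ≡ sumQ N g
  sumQ-cong zero    f g f≗g = refl
  sumQ-cong (suc N) f g f≗g = cong₂ _+_ (sumQ-cong N f g (λ i i<N → f≗g i (NP.m≤n⇒m≤1+n i<N))) (f≗g N NP.≤-refl)

  sumQ-zero : ∀ N f → (∀ i → i < N → f i ≡ 0ℚ) → sumQ N f ≡ 0ℚ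
  sumQ-zero zero    f f≗0 = refl
  sumQ-zero (suc N) f f≗0 =
    trans (cong₂ _+_ (sumQ-zero N f (λ i i<N → f≗0 i (NP.m≤n⇒m≤1+n i<N))) (f≗0 N NP.≤-refl)) (QP.+-identityʳ 0ℚ)

  sumQ-*ʳ : ∀ N f c → sumQ N f * c ≡ sumQ N (λ i → f i * c)
  sumQ-*ʳ zero    f c = QP.*-zeroˡ c
  sumQ-*ʳ (suc N) f c = trans (QP.*-distribʳ-+ c (sumQ N f) (f N)) (cong (_+ f N * c) (sumQ-*ʳ N f c))

  ℕ→ℚ-sumℕ : ∀ N f → ℕ→ℚ (sumℕ N f) ≡ sumQ N (λ i → ℕ→ℚ (f i))
  ℕ→ℚ-sumℕ zero    f = refl
  ℕ→ℚ-sumℕ (suc N) f = trans (ℕ→ℚ-+ (sumℕ N f) (f N)) (cong (_+ ℕ→ℚ (f N)) (ℕ→ℚ-sumℕ N f))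

  ℕ→ℚ-sumℕ-* : ∀ N f c → ℕ→ℚ (sumℕ N f) * c ≡ sumQ N (λ i → ℕ→ℚ (f i) * c)
  ℕ→ℚ-sumℕ-* N f c = trans (cong (_* c) (ℕ→ℚ-sumℕ N f)) (sumQ-*ʳ N _ c)

  rising : ℕ → ℕ → ℕ
  rising k zero    = 1
  rising k (suc i) = suc k ℕ.* rising (suc k) i

  rising-*-! : ∀ k i → rising k i ℕ.* k ! ≡ (k ℕ.+ i) !
  rising-*-! k zero    = trans (NP.+-identityʳ _) (cong _! (sym (NP.+-identityʳ k)))
  rising-*-! k (suc i) = begin
    suc k ℕ.* rising (suc k) i ℕ.* k !   ≡⟨ cong (ℕ._* k !) (NP.*-comm (suc k) (rising (suc k) i)) ⟩
    rising (suc k) i ℕ.* suc k ℕ.* k !   ≡⟨ NP.*-assoc (rising (suc k) i) (suc k) (k !) ⟩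
    rising (suc k) i ℕ.* (suc k !)       ≡⟨ rising-*-! (suc k) i ⟩
    (suc k ℕ.+ i) !                      ≡⟨ cong _! (NP.+-suc k i) ⟨
    (k ℕ.+ suc i) !                      ∎

  ∂x^-coefficient : ∀ i F n k → ∂x^ i F n k ≡ ℕ→ℚ (rising k i) * F n (k ℕ.+ i)
  ∂x^-coefficient zero    F n k = trans (sym (QP.*-identityˡ (F n k))) (cong (λ z → 1ℚ * F n z) (sym (NP.+-identityʳ k)))
  ∂x^-coefficient (suc i) F n k = begin
    ℕ→ℚ (suc k) * ∂x^ i F n (suc k)                                ≡⟨ cong (ℕ→ℚ (suc k) *_) (∂x^-coefficient i F n (suc k)) ⟩
    ℕ→ℚ (suc k) * (ℕ→ℚ (rising (suc k) i) * F n (suc k ℕ.+ i))    ≡⟨ QP.*-assoc (ℕ→ℚ (suc k)) _ _ ⟨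
    ℕ→ℚ (suc k) * ℕ→ℚ (rising (suc k) i) * F n (suc k ℕ.+ i)      ≡⟨ cong₂ _*_ (sym (ℕ→ℚ-* (suc k) (rising (suc k) i)))
                                                                                (cong (F n) (sym (NP.+-suc k i))) ⟩
    ℕ→ℚ (rising k (suc i)) * F n (k ℕ.+ suc i)                    ∎

  rising-*-inv! : ∀ k i → ℕ→ℚ (rising k i) * inv! (k ℕ.+ i) ≡ inv! k
  rising-*-inv! k i = begin
    r * u                  ≡⟨ QP.*-identityʳ (r * u) ⟨
    r * u * 1ℚ             ≡⟨ cong (r * u *_) (ℕ→ℚ-!-*-inv! k) ⟨
    r * u * (K * v)        ≡⟨ solve 4 (λ r u K v → r :* u :* (K :* v) := (r :* K) :* u :* v) refl r u K v ⟩
    (r * K) * u * v        ≡⟨ cong (λ z → z * u * v) (trans (sym (ℕ→ℚ-* (rising k i) (k !))) (cong ℕ→ℚ (rising-*-! k i))) ⟩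
    ℕ→ℚ ((k ℕ.+ i) !) * u * v ≡⟨ cong (_* v) (ℕ→ℚ-!-*-inv! (k ℕ.+ i)) ⟩
    1ℚ * v                 ≡⟨ QP.*-identityˡ v ⟩
    v                      ∎
    where
    r = ℕ→ℚ (rising k i)
    u = inv! (k ℕ.+ i)
    K = ℕ→ℚ (k !)
    v = inv! k


  C-*-! : ∀ k j → j ≤ k → (k C j) ℕ.* (j ! ℕ.* (k ∸ j) !) ≡ k !
  C-*-! k j j≤k = trans (cong (ℕ._* (j ! ℕ.* (k ∸ j) !)) (nCk≡n!/k![n-k]! j≤k))
                        (DM.m/n*n≡m {{j !* (k ∸ j) !≢0}} (k![n∸k]!∣n! j≤k))

  binomial-egf : ∀ k j x y → j ≤ k →
                 ℕ→ℚ ((k C j) ℕ.* x ℕ.* y) * inv! k ≡ (ℕ→ℚ x * inv! j) * (ℕ→ℚ y * inv! (k ∸ j))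
  binomial-egf k j x y j≤k = begin
    ℕ→ℚ ((k C j) ℕ.* x ℕ.* y) * v
      ≡⟨ cong (_* v) (trans (ℕ→ℚ-* ((k C j) ℕ.* x) y) (cong (_* Y) (ℕ→ℚ-* (k C j) x))) ⟩
    c * X′ * Y * v
      ≡⟨ trans (QP.*-identityʳ _) (QP.*-identityʳ _) ⟨
    c * X′ * Y * v * 1ℚ * 1ℚ
      ≡⟨ cong₂ (λ p q → c * X′ * Y * v * p * q) (ℕ→ℚ-!-*-inv! j) (ℕ→ℚ-!-*-inv! (k ∸ j)) ⟨
    c * X′ * Y * v * (j! * u) * ([k∸j]! * w)
      ≡⟨ solve 8 (λ c X′ Y v j! u [k∸j]! w → c :* X′ :* Y :* v :* (j! :* u) :* ([k∸j]! :* w) := (c :* (j! :* [k∸j]!)) :* v :* (X′ :* u) :* (Y :* w))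
               refl c X′ Y v j! u [k∸j]! w ⟩
    (c * (j! * [k∸j]!)) * v * (X′ * u) * (Y * w)
      ≡⟨ cong (λ z → z * v * (X′ * u) * (Y * w))
              (trans (cong (c *_) (sym (ℕ→ℚ-* (j !) ((k ∸ j) !))))
                     (trans (sym (ℕ→ℚ-* (k C j) (j ! ℕ.* (k ∸ j) !))) (cong ℕ→ℚ (C-*-! k j j≤k)))) ⟩
    ℕ→ℚ (k !) * v * (X′ * u) * (Y * w)
      ≡⟨ cong (λ z → z * (X′ * u) * (Y * w)) (ℕ→ℚ-!-*-inv! k) ⟩
    1ℚ * (X′ * u) * (Y * w)
      ≡⟨ cong (_* (Y * w)) (QP.*-identityˡ (X′ * u)) ⟩
    (X′ * u) * (Y * w) ∎
    where
    c = ℕ→ℚ (k C j)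
    X′ = ℕ→ℚ x
    Y = ℕ→ℚ y
    v = inv! k
    j! = ℕ→ℚ (j !)
    u = inv! j
    [k∸j]! = ℕ→ℚ ((k ∸ j) !)
    w = inv! (k ∸ j)

  varCount-egf : ∀ n k → ℕ→ℚ (varCount n k) * inv! k ≡ X n k
  varCount-egf zero    zero          = QP.*-zeroˡ (inv! 0)
  varCount-egf zero    (suc zero)    = refl
  varCount-egf zero    (suc (suc k)) = QP.*-zeroˡ (inv! (suc (suc k)))
  varCount-egf (suc n) k             = QP.*-zeroˡ (inv! k)

  neutral-equation : egf neutralCount ≗ₛ (X ⊕ (egf neutralCount ⊗ egf normalCount))
  neutral-equation n k = begin
    ℕ→ℚ (neutralCount n k) * inv! k
      ≡⟨ cong (λ z → ℕ→ℚ z * inv! k) (neutralCount-unfold n k) ⟩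
    ℕ→ℚ (varCount n k ℕ.+ appCount neutralCount normalCount n n k) * inv! k
      ≡⟨ trans (cong (_* inv! k) (ℕ→ℚ-+ (varCount n k) _)) (QP.*-distribʳ-+ (inv! k) (ℕ→ℚ (varCount n k)) _) ⟩
    ℕ→ℚ (varCount n k) * inv! k + ℕ→ℚ (appCount neutralCount normalCount n n k) * inv! k
      ≡⟨ cong₂ _+_ (varCount-egf n k) products ⟩
    X n k + (sumQ n product + product n) ∎
    where
    product : ℕ → ℚ
    product a = sumQ (suc k) λ j → egf neutralCount a j * egf normalCount (n ∸ a) (k ∸ j)
    -- the product's term a = n involves the normal count of size 0, which vanishes
    product-n : product n ≡ 0ℚ
    product-n = sumQ-zero (suc k) _ λ j _ → begin
      egf neutralCount n j * (ℕ→ℚ (normalCount (n ∸ n) (k ∸ j)) * inv! (k ∸ j))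
        ≡⟨ cong (λ z → egf neutralCount n j * (ℕ→ℚ (normalCount z (k ∸ j)) * inv! (k ∸ j))) (NP.n∸n≡0 n) ⟩
      egf neutralCount n j * (0ℚ * inv! (k ∸ j))
        ≡⟨ cong (egf neutralCount n j *_) (QP.*-zeroˡ (inv! (k ∸ j))) ⟩
      egf neutralCount n j * 0ℚ
        ≡⟨ QP.*-zeroʳ (egf neutralCount n j) ⟩
      0ℚ ∎
    products : ℕ→ℚ (appCount neutralCount normalCount n n k) * inv! k ≡ sumQ n product + product n
    products = begin
      ℕ→ℚ (appCount neutralCount normalCount n n k) * inv! k
        ≡⟨ cong (λ z → ℕ→ℚ z * inv! k) (appCount-binomial n n k) ⟩
      ℕ→ℚ (sumℕ n λ a → sumℕ (suc k) λ j → (k C j) ℕ.* neutralCount a j ℕ.* normalCount (n ∸ a) (k ∸ j)) * inv! k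
        ≡⟨ ℕ→ℚ-sumℕ-* n _ (inv! k) ⟩
      sumQ n (λ a → ℕ→ℚ (sumℕ (suc k) λ j → (k C j) ℕ.* neutralCount a j ℕ.* normalCount (n ∸ a) (k ∸ j)) * inv! k)
        ≡⟨ sumQ-cong n _ _ (λ a _ → trans (ℕ→ℚ-sumℕ-* (suc k) _ (inv! k))
             (sumQ-cong (suc k) _ _ λ j j≤k → binomial-egf k j _ _ (NP.≤-pred j≤k))) ⟩
      sumQ n product
        ≡⟨ trans (cong (sumQ n product +_) product-n) (QP.+-identityʳ (sumQ n product)) ⟨
      sumQ n product + product n ∎

  derivativeTerms : ℕ → FPS
  derivativeTerms i = scale (inv! i) (∂x^ i (egf neutralCount))

  derivativeTerms-vanish : ∀ n k i → suc (suc n) ≤ i → derivativeTerms i n k ≡ 0ℚ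
  derivativeTerms-vanish n k i n<i = begin
    inv! i * ∂x^ i (egf neutralCount) n k
      ≡⟨ cong (inv! i *_) (∂x^-coefficient i (egf neutralCount) n k) ⟩
    inv! i * (ℕ→ℚ (rising k i) * (ℕ→ℚ (neutralCount n (k ℕ.+ i)) * inv! (k ℕ.+ i)))
      ≡⟨ cong (λ z → inv! i * (ℕ→ℚ (rising k i) * (ℕ→ℚ z * inv! (k ℕ.+ i))))
              (neutralCount-vanishes n (k ℕ.+ i) (NP.≤-trans n<i (NP.m≤n+m i k))) ⟩
    inv! i * (ℕ→ℚ (rising k i) * (0ℚ * inv! (k ℕ.+ i)))
      ≡⟨ cong (λ z → inv! i * (ℕ→ℚ (rising k i) * z)) (QP.*-zeroˡ (inv! (k ℕ.+ i))) ⟩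
    inv! i * (ℕ→ℚ (rising k i) * 0ℚ)
      ≡⟨ cong (inv! i *_) (QP.*-zeroʳ (ℕ→ℚ (rising k i))) ⟩
    inv! i * 0ℚ
      ≡⟨ QP.*-zeroʳ (inv! i) ⟩
    0ℚ ∎

  derivativeSum : FPS
  derivativeSum n k = sumQ (suc (suc n)) λ i → derivativeTerms i n k

  derivativeSum-HasSum : HasSum derivativeTerms derivativeSum
  derivativeSum-HasSum n k = suc (suc n) , derivativeTerms-vanish n k , refl

  neutralCount-/!-* : ∀ c k i → neutralCount c (k ℕ.+ i) ≡ (neutralCount c (k ℕ.+ i) /! i) ℕ.* i !
  neutralCount-/!-* c k i =
    subst (λ k′ → neutralCount c (k′ ℕ.+ i) ≡ (neutralCount c (k′ ℕ.+ i) /! i) ℕ.* i !) (length-applyUpTo (λ j → j) k)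
      (proj₂ (NumClasses-NormalLams c (neutralCount c) (proj₁ (countsCorrect c)) i (upTo k) (Distinct-upTo k)))

  normalCount-term : ∀ c k i → ℕ→ℚ (neutralCount c (k ℕ.+ i) /! i) * inv! k ≡ derivativeTerms i c k
  normalCount-term c k i = sym (begin
    w * ∂x^ i (egf neutralCount) c k
      ≡⟨ cong (w *_) (∂x^-coefficient i (egf neutralCount) c k) ⟩
    w * (r * (ℕ→ℚ B * u))
      ≡⟨ cong (λ z → w * (r * (ℕ→ℚ z * u))) (neutralCount-/!-* c k i) ⟩
    w * (r * (ℕ→ℚ ((B /! i) ℕ.* i !) * u))
      ≡⟨ cong (λ z → w * (r * (z * u))) (ℕ→ℚ-* (B /! i) (i !)) ⟩
    w * (r * (D * I * u))
      ≡⟨ solve 5 (λ w r D I u → w :* (r :* (D :* I :* u)) := D :* (I :* w) :* (r :* u)) refl w r D I u ⟩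
    D * (I * w) * (r * u)
      ≡⟨ cong₂ (λ p q → D * p * q) (ℕ→ℚ-!-*-inv! i) (rising-*-inv! k i) ⟩
    D * 1ℚ * inv! k
      ≡⟨ cong (_* inv! k) (QP.*-identityʳ D) ⟩
    D * inv! k ∎)
    where
    B = neutralCount c (k ℕ.+ i)
    w = inv! i
    r = ℕ→ℚ (rising k i)
    u = inv! (k ℕ.+ i)
    D = ℕ→ℚ (B /! i)
    I = ℕ→ℚ (i !)

  normal-equation : egf normalCount ≗ₛ zMul derivativeSum
  normal-equation zero    k = QP.*-zeroˡ (inv! k)
  normal-equation (suc c) k =
    trans (ℕ→ℚ-sumℕ-* (suc (suc c)) _ (inv! k)) (sumQ-cong (suc (suc c)) _ _ λ i _ → normalCount-term c k i)

open Counting using (neutralCount; normalCount; countsNeutral; countsNormal)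
open Series using (neutral-equation; derivativeSum; derivativeSum-HasSum; normal-equation)

mainTheorem1 : Σ (ℕ → ℕ → ℕ) λ b → Σ (ℕ → ℕ → ℕ) λ r →
    CountsNeutral b × CountsNormal r
    × (egf b ≗ₛ (X ⊕ (egf b ⊗ egf r)))
    × Σ FPS (λ S → HasSum (λ i → scale (inv! i) (∂x^ i (egf b))) S × (egf r ≗ₛ zMul S))
mainTheorem1 =
  neutralCount , normalCount , countsNeutral , countsNormal , neutral-equation ,
  derivativeSum , derivativeSum-HasSum , normal-equation
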